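{- Call $m$ a switching point if $U_m$ is monolithic and $U_{m+1}$ is not. For any $\omega\to\infty$, with probability tending to $1$ there is no switching point $m\ge\omega$.
   Context: A chord diagram with $k$ chords is a perfect matching of the points $1,\dots,2k$ placed clockwise on a circle; two chords cross if their endpoints interleave, and components are those of the intersection graph (vertices = chords, edges = crossing pairs). A simple chord is one of the form $\langle i,i+1\rangle$ (addition modulo $2k$). The root component is the component containing the chord with endpoint $1$. A chord diagram is monolithic if (i) it consists only of the root component and simple chords, and (ii) there is no $i$ such that both $\langle i,i+1\rangle$ and $\langle i+2,i+3\rangle$ are chords. Continuous growth process: start with a circle with no chords; at step $1$ a chord is drawn and one of its endpoints is marked as reference. After step $k$ the $2k$ endpoints divide the circle into $2k$ arcs; at step $k+1$ one of the $\binom{2k+1}{2}$ choices of two distinct arcs or one arc twice is chosen uniformly at random independently of the past and a new chord is added with endpoints in the chosen arcs (only relative order matters). $U_k$ is the resulting diagram after step $k$ with endpoints labeled $1,\dots,2k$ clockwise from the reference endpoint. -}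

module Defs where

open import Data.Nat using (ℕ; zero; suc; _+_; _*_; _≤_; _<_; _<ᵇ_; _≡ᵇ_)
open import Data.Bool using (if_then_else_)
open import Data.Product using (_×_; _,_; proj₁; proj₂; Σ; ∃)
open import Data.Sum using (_⊎_)
open import Data.List using (List; []; _∷_; map; concatMap; upTo; take; length)
open import Data.List.Membership.Propositional using (_∈_)
open import Relation.Binary.PropositionalEquality using (_≡_)
open import Relation.Nullary using (¬_)

-- Endpoints are labelled 0,1,…,2k-1 clockwise (label 0 = the paper's
-- label 1, i.e. the reference endpoint).  A chord is stored as a pair
-- (x , y) with x < y; a diagram with k chords is a list of k chords
-- whose endpoints are exactly 0,…,2k-1 (this invariant holds for all
-- diagrams produced by the growth process below).

Chord : Set
Chord = ℕ × ℕ

Diagram : Set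
Diagram = List Chord

points : Diagram → ℕ
points D = 2 * length D

Cross : Chord → Chord → Set
Cross (a , b) (c , d) = (a < c × c < b × b < d) ⊎ (c < a × a < d × d < b)

data Root (D : Diagram) : Chord → Set where
  base : ∀ {c} → c ∈ D → (proj₁ c ≡ 0 ⊎ proj₂ c ≡ 0) → Root D c
  step : ∀ {c c'} → Root D c → c' ∈ D → Cross c c' → Root D c'

next : ℕ → ℕ → ℕ
next n i = if suc i ≡ᵇ n then 0 else suc i

IsChord : Diagram → ℕ → ℕ → Set
IsChord D i j = ((i , j) ∈ D) ⊎ ((j , i) ∈ D)

Simple : Diagram → Chord → Set
Simple D (x , y) = Σ ℕ λ i → i < points D ×
  (((x ≡ i) × (y ≡ next (points D) i)) ⊎ ((y ≡ i) × (x ≡ next (points D) i)))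

Monolithic : Diagram → Set
Monolithic D =
  (∀ c → c ∈ D → Root D c ⊎ Simple D c) ×
  ¬ (Σ ℕ λ i → i < points D ×
       IsChord D i (next n i) ×
       IsChord D (next n (next n i)) (next n (next n (next n i))))
  where n = points D

-- With k chords (k ≥ 1) present, arc i (0 ≤ i < 2k) is the arc between
-- endpoints i and i+1 (mod 2k).  A choice is a pair (a , b) with
-- a ≤ b < 2k: the two arcs (a = b meaning one arc twice); there are
-- exactly (2k+1 choose 2) choices.  The new chord gets endpoints
-- a+1 and b+2 in the new labelling, an old endpoint j becomes
-- j + [a < j] + [b < j]; the reference endpoint keeps label 0.

Choice : Set
Choice = ℕ × ℕ

allChoices : ℕ → List Choice
allChoices k = concatMap (λ b → map (λ a → (a , b)) (upTo (suc b))) (upTo (2 * k))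

shift : ℕ → ℕ → ℕ → ℕ
shift a b j = j + (if a <ᵇ j then 1 else 0) + (if b <ᵇ j then 1 else 0)

grow : Choice → Diagram → Diagram
grow (a , b) D = (suc a , b + 2) ∷ map (λ c → (shift a b (proj₁ c) , shift a b (proj₂ c))) D

U₁ : Diagram
U₁ = (0 , 1) ∷ []

build : List Choice → Diagram → Diagram
build [] D = D
build (c ∷ cs) D = build cs (grow c D)

-- U cs m : the diagram U_m when the choices made at steps 2,3,… are cs
U : List Choice → ℕ → Diagram
U cs zero = []
U cs (suc m) = build (take m cs) U₁

-- all (equally likely, pairwise distinct) choice sequences for steps
-- 2,…,n+1, the choice at step j+1 being taken from allChoices j
seqsFrom : ℕ → ℕ → List (List Choice)
seqsFrom k zero = [] ∷ []
seqsFrom k (suc n) = concatMap (λ c → map (c ∷_) (seqsFrom (suc k) n)) (allChoices k)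

allSeqs : ℕ → List (List Choice)
allSeqs n = seqsFrom 1 n

Switch : List Choice → ℕ → Set
Switch cs m = Monolithic (U cs m) × ¬ Monolithic (U cs (suc m))

SwitchIn : ℕ → ℕ → List Choice → Set
SwitchIn ω M cs = Σ ℕ λ m → ω ≤ m × m ≤ M × Switch cs m

-- P(event over the first n choices) ≤ 1/d :  some list containing every
-- sequence satisfying the event has length at most (number of sequences)/d
ProbAtMostInv : ℕ → ℕ → (List Choice → Set) → Set
ProbAtMostInv n d E = Σ (List (List Choice)) λ bad →
  (∀ cs → cs ∈ allSeqs n → E cs → cs ∈ bad) × (d * length bad ≤ length (allSeqs n))

-- Monolithic diagrams stay monolithic unless the new chord is drawn near a simple chord ⟨i , i + 1⟩,
-- i.e. with both ends in the three arcs around it.  Indeed, for any other choice the new chord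
-- either is itself a simple chord next to no other simple chord, or has an old endpoint strictly
-- inside it; the chord through that endpoint is then a root chord or a simple chord, and the two
-- exclusion rules of monolithicity turn the second case into the first, so the new chord crosses
-- the root component.  Old simple chords stay simple or get crossed by the new chord.
--
-- Hence a switching point at m needs a bad (m + 1)-st choice: at most 9 σ of the
-- #choices m ≥ m (m + 1) choices are bad, σ being the number of simple chords.  A simple chord
-- survives a step with probability 1 - 2m / #choices m and a new one appears with probability
-- at most 2m / #choices m, so E σ stays ≤ 2.  Thus P(switch at m) ≤ 18 / (m (m + 1)), and the sum over m ≥ ω telescopes
-- to 18 / ω.

module Submission where

open import Defs
open import Data.Bool using (Bool; true; false; if_then_else_; T; _∧_; _∨_; not)
open import Data.Bool.ListAction using (any)
open import Data.Bool.Properties using (∨-zeroʳ)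
open import Data.Empty using (⊥; ⊥-elim)
open import Data.List using (List; []; _∷_; _++_; _∷ʳ_; map; concatMap; upTo; length; take; filter)
open import Data.List.Properties using (applyUpTo-∷ʳ; length-map; length-upTo)
open import Data.List.Membership.Propositional using (_∈_; find; lose)
open import Data.List.Membership.Propositional.Properties
  using (∈-concatMap⁺; ∈-concatMap⁻; ∈-map⁺; ∈-map⁻; ∈-upTo⁻; ∈-filter⁺)
open import Data.List.Relation.Unary.Any using (here; there)
open import Data.Nat
open import Data.Nat.Properties
open import Algebra.Properties.CommutativeSemigroup +-commutativeSemigroup using (interchange)
open import Data.Nat.Solver using (module +-*-Solver)
open import Data.Product using (_×_; _,_; proj₁; proj₂; Σ)
open import Data.Sum using (_⊎_; inj₁; inj₂)
import Data.Sum as Sum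
open import Data.Unit using (tt)
open import Relation.Binary.Definitions using (tri<; tri≈; tri>)
open import Relation.Binary.PropositionalEquality
open import Relation.Nullary using (¬_; yes; no)
open import Relation.Nullary.Decidable using (T?)
open +-*-Solver using (solve; _:+_; _:*_; _:=_; con)

∑ : {A : Set} → List A → (A → ℕ) → ℕ
∑ []       f = 0
∑ (x ∷ xs) f = f x + ∑ xs f

module _ {A : Set} where

  ∑-++ : ∀ (xs ys : List A) f → ∑ (xs ++ ys) f ≡ ∑ xs f + ∑ ys f
  ∑-++ []       ys f = refl
  ∑-++ (x ∷ xs) ys f = trans (cong (f x +_) (∑-++ xs ys f)) (sym (+-assoc (f x) _ _))

  ∑-mono-≤ : ∀ (xs : List A) {f g} → (∀ x → x ∈ xs → f x ≤ g x) → ∑ xs f ≤ ∑ xs g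
  ∑-mono-≤ []       h = z≤n
  ∑-mono-≤ (x ∷ xs) h = +-mono-≤ (h x (here refl)) (∑-mono-≤ xs (λ y p → h y (there p)))

  ∑-cong : ∀ (xs : List A) {f g} → (∀ x → x ∈ xs → f x ≡ g x) → ∑ xs f ≡ ∑ xs g
  ∑-cong []       h = refl
  ∑-cong (x ∷ xs) h = cong₂ _+_ (h x (here refl)) (∑-cong xs (λ y p → h y (there p)))

  ∑-+ : ∀ (xs : List A) f g → ∑ xs (λ x → f x + g x) ≡ ∑ xs f + ∑ xs g
  ∑-+ []       f g = refl
  ∑-+ (x ∷ xs) f g = trans (cong (f x + g x +_) (∑-+ xs f g)) (interchange (f x) (g x) _ _)

  ∑-*ˡ : ∀ (xs : List A) c f → ∑ xs (λ x → c * f x) ≡ c * ∑ xs f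
  ∑-*ˡ []       c f = sym (*-zeroʳ c)
  ∑-*ˡ (x ∷ xs) c f = trans (cong (c * f x +_) (∑-*ˡ xs c f)) (sym (*-distribˡ-+ c (f x) _))

  ∑-*ʳ : ∀ (xs : List A) f c → ∑ xs (λ x → f x * c) ≡ ∑ xs f * c
  ∑-*ʳ xs f c = trans (∑-cong xs (λ x _ → *-comm (f x) c)) (trans (∑-*ˡ xs c f) (*-comm c _))

  ∑-const : ∀ (xs : List A) c → ∑ xs (λ _ → c) ≡ length xs * c
  ∑-const []       c = refl
  ∑-const (x ∷ xs) c = cong (c +_) (∑-const xs c)

  ∑-length : ∀ (xs : List A) → ∑ xs (λ _ → 1) ≡ length xs
  ∑-length xs = trans (∑-const xs 1) (*-identityʳ _)

module _ {A B : Set} where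

  ∑-map : ∀ (g : A → B) (xs : List A) f → ∑ (map g xs) f ≡ ∑ xs (λ x → f (g x))
  ∑-map g []       f = refl
  ∑-map g (x ∷ xs) f = cong (f (g x) +_) (∑-map g xs f)

  ∑-concatMap : ∀ (g : A → List B) (xs : List A) f →
    ∑ (concatMap g xs) f ≡ ∑ xs (λ x → ∑ (g x) f)
  ∑-concatMap g []       f = refl
  ∑-concatMap g (x ∷ xs) f =
    trans (∑-++ (g x) (concatMap g xs) f) (cong (∑ (g x) f +_) (∑-concatMap g xs f))

  ∑-swap : ∀ (xs : List A) (ys : List B) (f : A → B → ℕ) →
    ∑ xs (λ x → ∑ ys (f x)) ≡ ∑ ys (λ y → ∑ xs (λ x → f x y))
  ∑-swap []       ys f = sym (trans (∑-const ys 0) (*-zeroʳ (length ys)))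
  ∑-swap (x ∷ xs) ys f =
    trans (cong (∑ ys (f x) +_) (∑-swap xs ys f)) (sym (∑-+ ys (f x) _))

∑-upTo-suc : ∀ n f → ∑ (upTo (suc n)) f ≡ ∑ (upTo n) f + f n
∑-upTo-suc n f = begin
  ∑ (upTo (suc n)) f          ≡⟨ cong (λ l → ∑ l f) (sym (applyUpTo-∷ʳ (λ x → x) n)) ⟩
  ∑ (upTo n ++ n ∷ []) f      ≡⟨ ∑-++ (upTo n) (n ∷ []) f ⟩
  ∑ (upTo n) f + (f n + 0)    ≡⟨ cong (∑ (upTo n) f +_) (+-identityʳ (f n)) ⟩
  ∑ (upTo n) f + f n          ∎
  where open ≡-Reasoning

∑-upTo-mono-≤ : ∀ n {f g} → (∀ i → i < n → f i ≤ g i) → ∑ (upTo n) f ≤ ∑ (upTo n) g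
∑-upTo-mono-≤ n h = ∑-mono-≤ (upTo n) (λ i i∈ → h i (∈-upTo⁻ i∈))

∑-upTo-cong : ∀ n {f g} → (∀ i → i < n → f i ≡ g i) → ∑ (upTo n) f ≡ ∑ (upTo n) g
∑-upTo-cong n h = ∑-cong (upTo n) (λ i i∈ → h i (∈-upTo⁻ i∈))

#choices : ℕ → ℕ
#choices k = length (allChoices k)

#seqs : ℕ → ℕ → ℕ
#seqs k n = length (seqsFrom k n)

∑-allChoices : ∀ k g →
  ∑ (allChoices k) g ≡ ∑ (upTo (2 * k)) (λ b → ∑ (upTo (suc b)) (λ a → g (a , b)))
∑-allChoices k g =
  trans (∑-concatMap (λ b → map (λ a → (a , b)) (upTo (suc b))) (upTo (2 * k)) g)
        (∑-upTo-cong (2 * k) (λ b _ → ∑-map (λ a → (a , b)) (upTo (suc b)) g))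

#choices≡∑suc : ∀ k → #choices k ≡ ∑ (upTo (2 * k)) suc
#choices≡∑suc k = begin
  #choices k                                            ≡⟨ sym (∑-length (allChoices k)) ⟩
  ∑ (allChoices k) (λ _ → 1)                            ≡⟨ ∑-allChoices k (λ _ → 1) ⟩
  ∑ (upTo (2 * k)) (λ b → ∑ (upTo (suc b)) (λ _ → 1))  ≡⟨ ∑-upTo-cong (2 * k) upTo-ones ⟩
  ∑ (upTo (2 * k)) suc                                  ∎
  where
  open ≡-Reasoning
  upTo-ones : ∀ b → b < 2 * k → ∑ (upTo (suc b)) (λ _ → 1) ≡ suc b
  upTo-ones b _ = trans (∑-length (upTo (suc b))) (length-upTo (suc b))

2*∑suc : ∀ n → 2 * ∑ (upTo n) suc ≡ n * suc n
2*∑suc zero    = refl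
2*∑suc (suc n) = begin
  2 * ∑ (upTo (suc n)) suc          ≡⟨ cong (2 *_) (∑-upTo-suc n suc) ⟩
  2 * (∑ (upTo n) suc + suc n)      ≡⟨ *-distribˡ-+ 2 (∑ (upTo n) suc) (suc n) ⟩
  2 * ∑ (upTo n) suc + 2 * suc n    ≡⟨ cong (_+ 2 * suc n) (2*∑suc n) ⟩
  n * suc n + 2 * suc n             ≡⟨ solve 1 (λ n → n :* (con 1 :+ n) :+ con 2 :* (con 1 :+ n)
                                                    := (con 1 :+ n) :* (con 2 :+ n)) refl n ⟩
  suc n * suc (suc n)               ∎
  where open ≡-Reasoning

n≤∑suc : ∀ n → n ≤ ∑ (upTo n) suc
n≤∑suc zero    = z≤n
n≤∑suc (suc n) = subst (suc n ≤_) (sym (∑-upTo-suc n suc)) (m≤n+m (suc n) _)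

2k≤#choices : ∀ k → 2 * k ≤ #choices k
2k≤#choices k = subst (2 * k ≤_) (sym (#choices≡∑suc k)) (n≤∑suc (2 * k))

k*[1+k]≤#choices : ∀ k → k * suc k ≤ #choices k
k*[1+k]≤#choices k = *-cancelˡ-≤ 2 (begin
  2 * (k * suc k)            ≡⟨ solve 1 (λ k → con 2 :* (k :* (con 1 :+ k)) := (con 2 :* k) :* (con 1 :+ k)) refl k ⟩
  2 * k * suc k              ≤⟨ *-monoʳ-≤ (2 * k) (s≤s (m≤n*m k 2)) ⟩
  2 * k * suc (2 * k)        ≡⟨ sym (2*∑suc (2 * k)) ⟩
  2 * ∑ (upTo (2 * k)) suc   ≡⟨ cong (2 *_) (sym (#choices≡∑suc k)) ⟩
  2 * #choices k             ∎)
  where open ≤-Reasoning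

∑-seqsFrom-suc : ∀ k n (f : List Choice → ℕ) →
  ∑ (seqsFrom k (suc n)) f ≡ ∑ (allChoices k) (λ c → ∑ (seqsFrom (suc k) n) (λ cs → f (c ∷ cs)))
∑-seqsFrom-suc k n f =
  trans (∑-concatMap (λ c → map (c ∷_) (seqsFrom (suc k) n)) (allChoices k) f)
        (∑-cong (allChoices k) (λ c _ → ∑-map (c ∷_) (seqsFrom (suc k) n) f))

∑-seqsFrom-snoc : ∀ k n (f : List Choice → ℕ) →
  ∑ (seqsFrom k (suc n)) f ≡ ∑ (seqsFrom k n) (λ cs → ∑ (allChoices (k + n)) (λ c → f (cs ∷ʳ c)))
∑-seqsFrom-snoc k zero f = begin
  ∑ (seqsFrom k 1) f                                 ≡⟨ ∑-seqsFrom-suc k 0 f ⟩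
  ∑ (allChoices k) (λ c → f (c ∷ []) + 0)            ≡⟨ ∑-cong (allChoices k) (λ c _ → +-identityʳ _) ⟩
  ∑ (allChoices k) (λ c → f (c ∷ []))                ≡⟨ cong (λ z → ∑ (allChoices z) (λ c → f (c ∷ []))) (sym (+-identityʳ k)) ⟩
  ∑ (allChoices (k + 0)) (λ c → f (c ∷ []))          ≡⟨ sym (+-identityʳ _) ⟩
  ∑ (allChoices (k + 0)) (λ c → f (c ∷ [])) + 0      ∎
  where open ≡-Reasoning
∑-seqsFrom-snoc k (suc n) f = begin
  ∑ (seqsFrom k (suc (suc n))) f
    ≡⟨ ∑-seqsFrom-suc k (suc n) f ⟩
  ∑ (allChoices k) (λ c → ∑ (seqsFrom (suc k) (suc n)) (λ cs → f (c ∷ cs)))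
    ≡⟨ ∑-cong (allChoices k) (λ c _ → ∑-seqsFrom-snoc (suc k) n (λ cs → f (c ∷ cs))) ⟩
  ∑ (allChoices k) (λ c → ∑ (seqsFrom (suc k) n) (λ cs → ∑ (allChoices (suc k + n)) (λ c' → f (c ∷ cs ∷ʳ c'))))
    ≡⟨ cong (λ z → ∑ (allChoices k) (λ c → ∑ (seqsFrom (suc k) n) (λ cs → ∑ (allChoices z) (λ c' → f (c ∷ cs ∷ʳ c')))))
            (sym (+-suc k n)) ⟩
  ∑ (allChoices k) (λ c → ∑ (seqsFrom (suc k) n) (λ cs → ∑ (allChoices (k + suc n)) (λ c' → f (c ∷ cs ∷ʳ c'))))
    ≡⟨ sym (∑-seqsFrom-suc k n (λ cs → ∑ (allChoices (k + suc n)) (λ c → f (cs ∷ʳ c)))) ⟩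
  ∑ (seqsFrom k (suc n)) (λ cs → ∑ (allChoices (k + suc n)) (λ c → f (cs ∷ʳ c)))
    ∎
  where open ≡-Reasoning

#seqs-suc : ∀ k n → #seqs k (suc n) ≡ #choices k * #seqs (suc k) n
#seqs-suc k n = begin
  #seqs k (suc n)                                             ≡⟨ sym (∑-length (seqsFrom k (suc n))) ⟩
  ∑ (seqsFrom k (suc n)) (λ _ → 1)                            ≡⟨ ∑-seqsFrom-suc k n (λ _ → 1) ⟩
  ∑ (allChoices k) (λ _ → ∑ (seqsFrom (suc k) n) (λ _ → 1))  ≡⟨ ∑-const (allChoices k) _ ⟩
  #choices k * ∑ (seqsFrom (suc k) n) (λ _ → 1)              ≡⟨ cong (#choices k *_) (∑-length (seqsFrom (suc k) n)) ⟩
  #choices k * #seqs (suc k) n                                ∎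
  where open ≡-Reasoning

#seqs-+ : ∀ k j n → #seqs k (j + n) ≡ #seqs k j * #seqs (k + j) n
#seqs-+ k zero    n = trans (cong (λ z → #seqs z n) (sym (+-identityʳ k))) (sym (+-identityʳ _))
#seqs-+ k (suc j) n = begin
  #seqs k (suc (j + n))                                     ≡⟨ #seqs-suc k (j + n) ⟩
  #choices k * #seqs (suc k) (j + n)                        ≡⟨ cong (#choices k *_) (#seqs-+ (suc k) j n) ⟩
  #choices k * (#seqs (suc k) j * #seqs (suc k + j) n)      ≡⟨ sym (*-assoc (#choices k) _ _) ⟩
  #choices k * #seqs (suc k) j * #seqs (suc k + j) n        ≡⟨ cong₂ _*_ (sym (#seqs-suc k j))
                                                                         (cong (λ z → #seqs z n) (sym (+-suc k j))) ⟩
  #seqs k (suc j) * #seqs (k + suc j) n                     ∎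
  where open ≡-Reasoning

data WellFormed : ℕ → List Choice → Set where
  []  : ∀ {k} → WellFormed k []
  _∷_ : ∀ {k a b cs} → a ≤ b × b < 2 * k → WellFormed (suc k) cs → WellFormed k ((a , b) ∷ cs)

∈-allChoices⁻ : ∀ k {a b} → (a , b) ∈ allChoices k → a ≤ b × b < 2 * k
∈-allChoices⁻ k {a} {b} p
  with b' , b'∈ , q ← find (∈-concatMap⁻ (λ b → map (λ a → (a , b)) (upTo (suc b))) {xs = upTo (2 * k)} p)
  with a' , a'∈ , refl ← ∈-map⁻ (λ a → (a , b')) q
  = s≤s⁻¹ (∈-upTo⁻ a'∈) , ∈-upTo⁻ b'∈

∈-seqsFrom⁻ : ∀ k n {cs} → cs ∈ seqsFrom k n → WellFormed k cs × length cs ≡ n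
∈-seqsFrom⁻ k zero    (here refl) = [] , refl
∈-seqsFrom⁻ k (suc n) p
  with c , c∈ , q ← find (∈-concatMap⁻ (λ c → map (c ∷_) (seqsFrom (suc k) n)) {xs = allChoices k} p)
  with cs , cs∈ , refl ← ∈-map⁻ (c ∷_) q
  with wf , len ← ∈-seqsFrom⁻ (suc k) n cs∈
  = ∈-allChoices⁻ k c∈ ∷ wf , cong suc len

build-snoc : ∀ cs c D → build (cs ∷ʳ c) D ≡ grow c (build cs D)
build-snoc []       c D = refl
build-snoc (x ∷ cs) c D = build-snoc cs c (grow x D)

<⇒<ᵇ≡true : ∀ {m n} → m < n → (m <ᵇ n) ≡ true
<⇒<ᵇ≡true {m} {n} p with m <ᵇ n in eq
... | true  = refl
... | false = ⊥-elim (subst T eq (<⇒<ᵇ p))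

≥⇒<ᵇ≡false : ∀ {m n} → n ≤ m → (m <ᵇ n) ≡ false
≥⇒<ᵇ≡false {m} {n} p with m <ᵇ n in eq
... | false = refl
... | true  = ⊥-elim (<⇒≱ (<ᵇ⇒< m n (subst T (sym eq) tt)) p)

≡ᵇ-refl : ∀ m → (m ≡ᵇ m) ≡ true
≡ᵇ-refl zero    = refl
≡ᵇ-refl (suc m) = ≡ᵇ-refl m

≢⇒≡ᵇ≡false : ∀ {m n} → m ≢ n → (m ≡ᵇ n) ≡ false
≢⇒≡ᵇ≡false {m} {n} p with m ≡ᵇ n in eq
... | false = refl
... | true  = ⊥-elim (p (≡ᵇ⇒≡ m n (subst T (sym eq) tt)))

≡ᵇ≡true⇒≡ : ∀ {m n} → (m ≡ᵇ n) ≡ true → m ≡ n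
≡ᵇ≡true⇒≡ {m} {n} eq = ≡ᵇ⇒≡ m n (subst T (sym eq) tt)

next-view : ∀ n i → i < n → (suc i < n × next n i ≡ suc i) ⊎ (suc i ≡ n × next n i ≡ 0)
next-view n i p with suc i ≟ n
... | yes refl = inj₂ (refl , cong (if_then 0 else suc i) (≡ᵇ-refl (suc i)))
... | no ne    = inj₁ (≤∧≢⇒< p ne , cong (if_then 0 else suc i) (≢⇒≡ᵇ≡false ne))

next-suc : ∀ n i → suc i < n → next n i ≡ suc i
next-suc n i p with next-view n i (<-trans (n<1+n i) p)
... | inj₁ (_ , e) = e
... | inj₂ (e , _) = ⊥-elim (<-irrefl e p)

next-last : ∀ n i → suc i ≡ n → next n i ≡ 0
next-last n i e with next-view n i (subst (i <_) e (n<1+n i))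
... | inj₁ (p , _) = ⊥-elim (<-irrefl e p)
... | inj₂ (_ , e') = e'

next-< : ∀ n i → i < n → next n i < n
next-< n i p with next-view n i p
... | inj₁ (q , e) = subst (_< n) (sym e) q
... | inj₂ (_ , e) = subst (_< n) (sym e) (≤-<-trans z≤n p)

next≡suc⇒≡ : ∀ {n i x} → i < n → next n i ≡ suc x → i ≡ x
next≡suc⇒≡ {n} {i} p e with next-view n i p
... | inj₁ (_ , e') = suc-injective (trans (sym e') e)
... | inj₂ (_ , e') with () ← trans (sym e') e

shift-view : ∀ a b j → a ≤ b →
  (j ≤ a × shift a b j ≡ j) ⊎ (a < j × j ≤ b × shift a b j ≡ suc j) ⊎ (b < j × shift a b j ≡ suc (suc j))
shift-view a b j a≤b with j ≤? a
... | yes j≤a rewrite ≥⇒<ᵇ≡false j≤a | ≥⇒<ᵇ≡false {b} {j} (≤-trans j≤a a≤b) =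
  inj₁ (j≤a , trans (+-identityʳ _) (+-identityʳ j))
... | no j≰a with j ≤? b
...   | yes j≤b rewrite <⇒<ᵇ≡true (≰⇒> j≰a) | ≥⇒<ᵇ≡false {b} {j} j≤b =
  inj₂ (inj₁ (≰⇒> j≰a , j≤b , trans (+-identityʳ _) (+-comm j 1)))
...   | no j≰b rewrite <⇒<ᵇ≡true (≰⇒> j≰a) | <⇒<ᵇ≡true (≰⇒> j≰b) =
  inj₂ (inj₂ (≰⇒> j≰b , trans (+-assoc j 1 1) (+-comm j 2)))

module Shift (a b : ℕ) (a≤b : a ≤ b) where

  sh : ℕ → ℕ
  sh = shift a b

  sh-low : ∀ {q} → q ≤ a → sh q ≡ q
  sh-low {q} p with shift-view a b q a≤b
  ... | inj₁ (_ , e)               = e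
  ... | inj₂ (inj₁ (a<q , _ , _)) = ⊥-elim (<⇒≱ a<q p)
  ... | inj₂ (inj₂ (b<q , _))     = ⊥-elim (<⇒≱ (≤-<-trans a≤b b<q) p)

  sh-mid : ∀ {q} → a < q → q ≤ b → sh q ≡ suc q
  sh-mid {q} p r with shift-view a b q a≤b
  ... | inj₁ (q≤a , _)            = ⊥-elim (<⇒≱ p q≤a)
  ... | inj₂ (inj₁ (_ , _ , e))   = e
  ... | inj₂ (inj₂ (b<q , _))     = ⊥-elim (<⇒≱ b<q r)

  sh-high : ∀ {q} → b < q → sh q ≡ suc (suc q)
  sh-high {q} p with shift-view a b q a≤b
  ... | inj₁ (q≤a , _)            = ⊥-elim (<⇒≱ p (≤-trans q≤a a≤b))
  ... | inj₂ (inj₁ (_ , q≤b , _)) = ⊥-elim (<⇒≱ p q≤b)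
  ... | inj₂ (inj₂ (_ , e))       = e

  sh-0 : sh 0 ≡ 0
  sh-0 = sh-low z≤n

  sh-mono-< : ∀ {x y} → x < y → sh x < sh y
  sh-mono-< {x} {y} x<y with shift-view a b x a≤b | shift-view a b y a≤b
  ... | inj₁ (_ , ex) | inj₁ (_ , ey) rewrite ex | ey = x<y
  ... | inj₁ (_ , ex) | inj₂ (inj₁ (_ , _ , ey)) rewrite ex | ey = m<n⇒m<1+n x<y
  ... | inj₁ (_ , ex) | inj₂ (inj₂ (_ , ey)) rewrite ex | ey = m<n⇒m<1+n (m<n⇒m<1+n x<y)
  ... | inj₂ (inj₁ (a<x , _ , _)) | inj₁ (y≤a , _) = ⊥-elim (<⇒≱ (<-trans a<x x<y) y≤a)
  ... | inj₂ (inj₁ (_ , _ , ex)) | inj₂ (inj₁ (_ , _ , ey)) rewrite ex | ey = s<s x<y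
  ... | inj₂ (inj₁ (_ , _ , ex)) | inj₂ (inj₂ (_ , ey)) rewrite ex | ey = s<s (m<n⇒m<1+n x<y)
  ... | inj₂ (inj₂ (b<x , _)) | inj₁ (y≤a , _) = ⊥-elim (<⇒≱ (<-trans b<x x<y) (≤-trans y≤a a≤b))
  ... | inj₂ (inj₂ (b<x , _)) | inj₂ (inj₁ (_ , y≤b , _)) = ⊥-elim (<⇒≱ (<-trans b<x x<y) y≤b)
  ... | inj₂ (inj₂ (_ , ex)) | inj₂ (inj₂ (_ , ey)) rewrite ex | ey = s<s (s<s x<y)

  sh-injective : ∀ {x y} → sh x ≡ sh y → x ≡ y
  sh-injective {x} {y} e with <-cmp x y
  ... | tri< p _ _ = ⊥-elim (<-irrefl e (sh-mono-< p))
  ... | tri≈ _ p _ = p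
  ... | tri> _ _ p = ⊥-elim (<-irrefl (sym e) (sh-mono-< p))

  sh-≥ : ∀ j → j ≤ sh j
  sh-≥ j with shift-view a b j a≤b
  ... | inj₁ (_ , e)              rewrite e = ≤-refl
  ... | inj₂ (inj₁ (_ , _ , e))   rewrite e = n≤1+n j
  ... | inj₂ (inj₂ (_ , e))       rewrite e = m≤n+m j 2

  sh-≤ : ∀ j → sh j ≤ suc (suc j)
  sh-≤ j with shift-view a b j a≤b
  ... | inj₁ (_ , e)              rewrite e = m≤n+m j 2
  ... | inj₂ (inj₁ (_ , _ , e))   rewrite e = n≤1+n (suc j)
  ... | inj₂ (inj₂ (_ , e))       rewrite e = ≤-refl

  sh-> : ∀ {j} → a < j → j < sh j
  sh-> {j} a<j with shift-view a b j a≤b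
  ... | inj₁ (j≤a , _)            = ⊥-elim (<⇒≱ a<j j≤a)
  ... | inj₂ (inj₁ (_ , _ , e))   rewrite e = n<1+n j
  ... | inj₂ (inj₂ (_ , e))       rewrite e = m<n+m j {2} (s≤s z≤n)

  sh-suc : ∀ {i} → a ≢ i → b ≢ i → sh (suc i) ≡ suc (sh i)
  sh-suc {i} a≢i b≢i with shift-view a b i a≤b
  ... | inj₁ (i≤a , e)            rewrite e = sh-low (≤∧≢⇒< i≤a (≢-sym a≢i))
  ... | inj₂ (inj₁ (a<i , i≤b , e)) rewrite e = sh-mid (m<n⇒m<1+n a<i) (≤∧≢⇒< i≤b (≢-sym b≢i))
  ... | inj₂ (inj₂ (b<i , e))     rewrite e = sh-high (m<n⇒m<1+n b<i)

  sh≢new₁ : ∀ j → sh j ≢ suc a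
  sh≢new₁ j e with shift-view a b j a≤b
  ... | inj₁ (j≤a , e')           = <-irrefl (trans (sym e') e) (s≤s j≤a)
  ... | inj₂ (inj₁ (a<j , _ , e')) = <-irrefl (sym (trans (sym e') e)) (s<s a<j)
  ... | inj₂ (inj₂ (b<j , e'))    = <-irrefl (sym (trans (sym e') e)) (s<s (m<n⇒m<1+n (≤-<-trans a≤b b<j)))

  sh≢new₂ : ∀ j → sh j ≢ suc (suc b)
  sh≢new₂ j e with shift-view a b j a≤b
  ... | inj₁ (j≤a , e')           = <-irrefl (trans (sym e') e) (≤-<-trans (≤-trans j≤a a≤b) (m<n+m b {2} (s≤s z≤n)))
  ... | inj₂ (inj₁ (_ , j≤b , e')) = <-irrefl (trans (sym e') e) (s<s (s≤s j≤b))
  ... | inj₂ (inj₂ (b<j , e'))    = <-irrefl (sym (trans (sym e') e)) (s<s (s<s b<j))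

  sh-<-reflect : ∀ {n q} → b < n → sh q < suc (suc n) → q < n
  sh-<-reflect {n} {q} b<n p with shift-view a b q a≤b
  ... | inj₁ (q≤a , _)            = ≤-<-trans (≤-trans q≤a a≤b) b<n
  ... | inj₂ (inj₁ (_ , q≤b , _)) = ≤-<-trans q≤b b<n
  ... | inj₂ (inj₂ (_ , e))       = ≤-pred (≤-pred (subst (_< suc (suc n)) e p))

  sh-surjective : ∀ p → p ≢ suc a → p ≢ suc (suc b) → Σ ℕ λ q → sh q ≡ p
  sh-surjective p p≢new₁ p≢new₂ with p ≤? a
  ... | yes p≤a = p , sh-low p≤a
  ... | no p≰a with p ≤? suc b
  sh-surjective zero          _ _ | no p≰a | _ = ⊥-elim (p≰a z≤n)
  sh-surjective (suc q) p≢new₁ _ | no p≰a | yes p≤1+b =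
    q , sh-mid (≤∧≢⇒< (≤-pred (≰⇒> p≰a)) (λ e → p≢new₁ (cong suc (sym e)))) (≤-pred p≤1+b)
  sh-surjective (suc zero) _ _ | no _ | no p≰1+b = ⊥-elim (p≰1+b (s≤s z≤n))
  sh-surjective (suc (suc q)) _ p≢new₂ | no _ | no p≰1+b =
    q , sh-high (≤∧≢⇒< (≤-pred (≤-pred (≰⇒> p≰1+b))) (λ e → p≢new₂ (cong (λ z → suc (suc z)) (sym e))))

record IsMatching (k : ℕ) (D : Diagram) : Set where
  field
    length≡   : length D ≡ k
    ordered   : ∀ {x y} → (x , y) ∈ D → x < y
    bounded   : ∀ {x y} → (x , y) ∈ D → y < 2 * k
    covering  : ∀ p → p < 2 * k → Σ ℕ λ q → IsChord D p q
    partner-unique : ∀ {p q r} → IsChord D p q → IsChord D p r → q ≡ r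

open IsMatching

IsChord-sym : ∀ {D p q} → IsChord D p q → IsChord D q p
IsChord-sym (inj₁ m) = inj₂ m
IsChord-sym (inj₂ m) = inj₁ m

IsChord-bounded : ∀ {k D p q} → IsMatching k D → IsChord D p q → p < 2 * k × q < 2 * k
IsChord-bounded M (inj₁ m) = <-trans (ordered M m) (bounded M m) , bounded M m
IsChord-bounded M (inj₂ m) = bounded M m , <-trans (ordered M m) (bounded M m)

points≡ : ∀ {k D} → IsMatching k D → points D ≡ 2 * k
points≡ M = cong (2 *_) (length≡ M)

isMatching-U₁ : IsMatching 1 U₁
isMatching-U₁ = record
  { length≡ = refl ; ordered = ord ; bounded = bnd ; covering = cov ; partner-unique = uni }
  where
  ord : ∀ {x y} → (x , y) ∈ U₁ → x < y
  ord (here refl) = s≤s z≤n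
  bnd : ∀ {x y} → (x , y) ∈ U₁ → y < 2
  bnd (here refl) = s≤s (s≤s z≤n)
  cov : ∀ p → p < 2 → Σ ℕ λ q → IsChord U₁ p q
  cov zero       _ = 1 , inj₁ (here refl)
  cov (suc zero) _ = 0 , inj₂ (here refl)
  cov (suc (suc p)) (s≤s (s≤s ()))
  uni : ∀ {p q r} → IsChord U₁ p q → IsChord U₁ p r → q ≡ r
  uni (inj₁ (here refl)) (inj₁ (here refl)) = refl
  uni (inj₂ (here refl)) (inj₂ (here refl)) = refl
  uni (inj₁ (here refl)) (inj₂ (here ()))
  uni (inj₂ (here refl)) (inj₁ (here ()))

module Grow (a b : ℕ) (a≤b : a ≤ b) (D : Diagram) where

  open Shift a b a≤b public

  new : Chord
  new = (suc a , suc (suc b))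

  D' : Diagram
  D' = grow (a , b) D

  new∈ : new ∈ D'
  new∈ = subst (λ z → (suc a , z) ∈ D') (+-comm b 2) (here refl)

  img∈ : ∀ {x y} → (x , y) ∈ D → (sh x , sh y) ∈ D'
  img∈ m = there (∈-map⁺ _ m)

  ∈-grow⁻ : ∀ {e} → e ∈ D' → e ≡ new ⊎ Σ ℕ λ x → Σ ℕ λ y → (x , y) ∈ D × e ≡ (sh x , sh y)
  ∈-grow⁻ (here refl) = inj₁ (cong (suc a ,_) (+-comm b 2))
  ∈-grow⁻ (there m) with (x , y) , m' , refl ← ∈-map⁻ _ m = inj₂ (x , y , m' , refl)

  IsChord-grow⁻ : ∀ {p q} → IsChord D' p q →
    (p ≡ suc a × q ≡ suc (suc b)) ⊎ (q ≡ suc a × p ≡ suc (suc b)) ⊎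
    Σ ℕ λ x → Σ ℕ λ y → IsChord D x y × p ≡ sh x × q ≡ sh y
  IsChord-grow⁻ (inj₁ m) with ∈-grow⁻ m
  ... | inj₁ refl                = inj₁ (refl , refl)
  ... | inj₂ (x , y , m' , refl) = inj₂ (inj₂ (x , y , inj₁ m' , refl , refl))
  IsChord-grow⁻ (inj₂ m) with ∈-grow⁻ m
  ... | inj₁ refl                = inj₂ (inj₁ (refl , refl))
  ... | inj₂ (x , y , m' , refl) = inj₂ (inj₂ (y , x , inj₂ m' , refl , refl))

  IsChord-img : ∀ {x y} → IsChord D x y → IsChord D' (sh x) (sh y)
  IsChord-img (inj₁ m) = inj₁ (img∈ m)
  IsChord-img (inj₂ m) = inj₂ (img∈ m)

  isMatching-grow : ∀ {k} → IsMatching k D → b < 2 * k → IsMatching (suc k) D'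
  isMatching-grow {k} M b<2k = record
    { length≡ = cong suc (trans (length-map _ D) (length≡ M))
    ; ordered = ord ; bounded = bnd ; covering = cov ; partner-unique = uni }
    where
    2+< : ∀ {j} → j < 2 * k → suc (suc j) < 2 * suc k
    2+< {j} p = subst (suc (suc j) <_) (sym (*-suc 2 k)) (s<s (s<s p))
    ord : ∀ {x y} → (x , y) ∈ D' → x < y
    ord m with ∈-grow⁻ m
    ... | inj₁ refl                = s≤s (s≤s a≤b)
    ... | inj₂ (x , y , m' , refl) = sh-mono-< (ordered M m')
    bnd : ∀ {x y} → (x , y) ∈ D' → y < 2 * suc k
    bnd m with ∈-grow⁻ m
    ... | inj₁ refl                = 2+< b<2k
    ... | inj₂ (x , y , m' , refl) = ≤-<-trans (sh-≤ y) (2+< (bounded M m'))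
    cov : ∀ p → p < 2 * suc k → Σ ℕ λ q → IsChord D' p q
    cov p p< with p ≟ suc a | p ≟ suc (suc b)
    ... | yes refl | _        = suc (suc b) , inj₁ new∈
    ... | no _     | yes refl = suc a , inj₂ new∈
    ... | no ≢new₁ | no ≢new₂ with q , refl ← sh-surjective p ≢new₁ ≢new₂
          with r , ic ← covering M q (sh-<-reflect b<2k (subst (sh q <_) (*-suc 2 k) p<))
          = sh r , IsChord-img ic
    uni : ∀ {p q r} → IsChord D' p q → IsChord D' p r → q ≡ r
    uni i1 i2 with IsChord-grow⁻ i1 | IsChord-grow⁻ i2
    ... | inj₁ (_ , refl) | inj₁ (_ , refl) = refl
    ... | inj₁ (refl , _) | inj₂ (inj₁ (_ , e)) = ⊥-elim (<-irrefl e (s≤s (s≤s a≤b)))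
    ... | inj₁ (refl , _) | inj₂ (inj₂ (x , _ , _ , e , _)) = ⊥-elim (sh≢new₁ x (sym e))
    ... | inj₂ (inj₁ (_ , e)) | inj₁ (refl , _) = ⊥-elim (<-irrefl e (s≤s (s≤s a≤b)))
    ... | inj₂ (inj₁ (refl , _)) | inj₂ (inj₁ (refl , _)) = refl
    ... | inj₂ (inj₁ (_ , refl)) | inj₂ (inj₂ (x , _ , _ , e , _)) = ⊥-elim (sh≢new₂ x (sym e))
    ... | inj₂ (inj₂ (x , _ , _ , e , _)) | inj₁ (refl , _) = ⊥-elim (sh≢new₁ x (sym e))
    ... | inj₂ (inj₂ (x , _ , _ , e , _)) | inj₂ (inj₁ (_ , refl)) = ⊥-elim (sh≢new₂ x (sym e))
    ... | inj₂ (inj₂ (x , y , ic , refl , refl)) | inj₂ (inj₂ (x' , y' , ic' , e , refl))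
      with refl ← sh-injective {x} {x'} e = cong sh (partner-unique M ic ic')

iverson : Bool → ℕ
iverson true  = 1
iverson false = 0

any≡false⇒ : ∀ {A : Set} (p : A → Bool) xs {x} → any p xs ≡ false → x ∈ xs → p x ≡ false
any≡false⇒ p (y ∷ xs) e (here refl) with p y
... | false = refl
any≡false⇒ p (y ∷ xs) e (there m) with p y
... | false = any≡false⇒ p xs e m

iverson-any≤ : ∀ {A : Set} (p : A → Bool) xs → iverson (any p xs) ≤ ∑ xs (λ x → iverson (p x))
iverson-any≤ p []       = z≤n
iverson-any≤ p (x ∷ xs) with p x
... | true  = s≤s z≤n
... | false = iverson-any≤ p xs

prev : ℕ → ℕ → ℕ
prev n zero    = pred n
prev n (suc i) = i

prev-next : ∀ n i → i < n → prev n (next n i) ≡ i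
prev-next n i p with next-view n i p
... | inj₁ (_ , e)  rewrite e  = refl
... | inj₂ (e , e') rewrite e' = cong pred (sym e)

-- A chord (x , y) with x < y is simple on a circle of n points iff y = x + 1, or x = 0 and y = n - 1;
-- simpleStart gives the i with (x , y) = ⟨i , i + 1 mod n⟩.
isSimpleᵇ : ℕ → Chord → Bool
isSimpleᵇ n (x , y) = (suc x ≡ᵇ y) ∨ ((x ≡ᵇ 0) ∧ (suc y ≡ᵇ n))

simpleStart : ℕ → Chord → ℕ
simpleStart n (x , y) = if suc x ≡ᵇ y then x else y

isSimpleᵇ≡true⇒ : ∀ {n x y} → isSimpleᵇ n (x , y) ≡ true → suc x ≡ y ⊎ (x ≡ 0 × suc y ≡ n)
isSimpleᵇ≡true⇒ {n} {x} {y} h with suc x ≡ᵇ y in e₁ | x ≡ᵇ 0 in e₂ | suc y ≡ᵇ n in e₃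
... | true  | _    | _    = inj₁ (≡ᵇ≡true⇒≡ e₁)
... | false | true | true = inj₂ (≡ᵇ≡true⇒≡ e₂ , ≡ᵇ≡true⇒≡ e₃)

consecutive-simple : ∀ n x → isSimpleᵇ n (x , suc x) ≡ true × simpleStart n (x , suc x) ≡ x
consecutive-simple n x rewrite ≡ᵇ-refl x = refl , refl

wrap-simple : ∀ {n y} → 1 ≢ y → suc y ≡ n → isSimpleᵇ n (0 , y) ≡ true × simpleStart n (0 , y) ≡ y
wrap-simple {y = y} 1≢y refl rewrite ≢⇒≡ᵇ≡false 1≢y | ≡ᵇ-refl y = refl , refl

Around : ℕ → ℕ → ℕ → Set
Around n i z = z ≡ prev n i ⊎ z ≡ i ⊎ z ≡ next n i

aroundᵇ : ℕ → ℕ → ℕ → Bool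
aroundᵇ n i z = (z ≡ᵇ prev n i) ∨ (z ≡ᵇ i) ∨ (z ≡ᵇ next n i)

-- Arc j lies between endpoints j and j + 1, so the arcs adjacent to the chord ⟨i , i + 1⟩
-- are i - 1, i and i + 1.
nearᵇ : ℕ → ℕ → Choice → Bool
nearᵇ n i (a , b) = aroundᵇ n i a ∧ aroundᵇ n i b

badChoiceᵇ : ℕ → Diagram → Choice → Bool
badChoiceᵇ n D c = any (λ e → isSimpleᵇ n e ∧ nearᵇ n (simpleStart n e) c) D

Around⇒aroundᵇ : ∀ {n i z} → Around n i z → aroundᵇ n i z ≡ true
Around⇒aroundᵇ {n} {i} (inj₁ refl) rewrite ≡ᵇ-refl (prev n i) = refl
Around⇒aroundᵇ {n} {i} (inj₂ (inj₁ refl)) rewrite ≡ᵇ-refl i = ∨-zeroʳ _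
Around⇒aroundᵇ {n} {i} (inj₂ (inj₂ refl)) rewrite ≡ᵇ-refl (next n i) | ∨-zeroʳ (next n i ≡ᵇ i) = ∨-zeroʳ _

SimpleIn : ℕ → Chord → Set
SimpleIn n (x , y) = Σ ℕ λ i → i < n × (((x ≡ i) × (y ≡ next n i)) ⊎ ((y ≡ i) × (x ≡ next n i)))

TwoSimpleIn : ℕ → Diagram → Set
TwoSimpleIn n D = Σ ℕ λ i → i < n ×
  IsChord D i (next n i) × IsChord D (next n (next n i)) (next n (next n (next n i)))

-- Monolithic with points D generalised to any n, so that it can be transported along points D ≡ 2 * k.
MonolithicIn : ℕ → Diagram → Set
MonolithicIn n D = (∀ c → c ∈ D → Root D c ⊎ SimpleIn n c) × ¬ TwoSimpleIn n D

Monolithic⇒In : ∀ D → Monolithic D → MonolithicIn (points D) D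
Monolithic⇒In D (chords , noTwo) = (λ { (x , y) m → chords (x , y) m }) , noTwo

In⇒Monolithic : ∀ D → MonolithicIn (points D) D → Monolithic D
In⇒Monolithic D (chords , noTwo) = (λ { (x , y) m → chords (x , y) m }) , noTwo

SimpleAt : ℕ → Diagram → ℕ → Set
SimpleAt n D i = i < n × IsChord D i (next n i)

SimpleIn⇒SimpleAt : ∀ {n D x y} → (x , y) ∈ D → SimpleIn n (x , y) →
  Σ ℕ λ i → SimpleAt n D i × (((x ≡ i) × (y ≡ next n i)) ⊎ ((y ≡ i) × (x ≡ next n i)))
SimpleIn⇒SimpleAt m (i , i<n , inj₁ (refl , refl)) = i , (i<n , inj₁ m) , inj₁ (refl , refl)
SimpleIn⇒SimpleAt m (i , i<n , inj₂ (refl , refl)) = i , (i<n , inj₂ m) , inj₂ (refl , refl)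

-- With k ≥ 2 the chords ⟨0 , 1⟩ and ⟨0 , 2k - 1⟩ are different, so simpleStart is unambiguous.
SimpleAt⇒∈ : ∀ {k D i} → IsMatching k D → 2 ≤ k → SimpleAt (2 * k) D i →
  Σ Chord λ e → e ∈ D × isSimpleᵇ (2 * k) e ≡ true × simpleStart (2 * k) e ≡ i
SimpleAt⇒∈ {k} {D} {i} M k≥2 (i< , ic) with next-view (2 * k) i i< | ic
... | inj₁ (_ , e) | inj₁ m = _ , subst (λ z → (i , z) ∈ D) e m , consecutive-simple (2 * k) i
... | inj₁ (_ , e) | inj₂ m = ⊥-elim (<-asym (n<1+n i) (subst (_< i) e (ordered M m)))
... | inj₂ (_ , e) | inj₁ m = ⊥-elim (n≮0 (subst (i <_) e (ordered M m)))
... | inj₂ (i+1≡2k , e) | inj₂ m = _ , subst (λ z → (z , i) ∈ D) e m , wrap-simple 1≢i i+1≡2k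
  where
  1≢i : 1 ≢ i
  1≢i refl = <-irrefl i+1≡2k (≤-trans (n≤1+n 3) (*-monoʳ-≤ 2 k≥2))

Cross-sym : ∀ {c c'} → Cross c c' → Cross c' c
Cross-sym (inj₁ x) = inj₂ x
Cross-sym (inj₂ x) = inj₁ x

module GrowMonolithic (a b : ℕ) (a≤b : a ≤ b) (D : Diagram) (k : ℕ) (M : IsMatching k D)
                      (k≥2 : 2 ≤ k) (b<n : b < 2 * k) (mono : MonolithicIn (2 * k) D)
                      (good : badChoiceᵇ (2 * k) D (a , b) ≡ false) where

  open Grow a b a≤b D

  n n' : ℕ
  n  = 2 * k
  n' = 2 * suc k

  Cross-img : ∀ {x y u v} → Cross (x , y) (u , v) → Cross (sh x , sh y) (sh u , sh v)
  Cross-img (inj₁ (p , q , r)) = inj₁ (sh-mono-< p , sh-mono-< q , sh-mono-< r)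
  Cross-img (inj₂ (p , q , r)) = inj₂ (sh-mono-< p , sh-mono-< q , sh-mono-< r)

  Root-img : ∀ {x y} → Root D (x , y) → Root D' (sh x , sh y)
  Root-img (base m (inj₁ refl)) = base (img∈ m) (inj₁ sh-0)
  Root-img (base m (inj₂ refl)) = base (img∈ m) (inj₂ sh-0)
  Root-img (step {_ , _} r m c) = step (Root-img r) (img∈ m) (Cross-img c)

  not-near : ∀ {i} → SimpleAt n D i → Around n i a → Around n i b → ⊥
  not-near {i} si around-a around-b
    with e , e∈D , simple , refl ← SimpleAt⇒∈ M k≥2 si
    with any≡false⇒ _ D good e∈D
  ... | bad≡false rewrite simple | Around⇒aroundᵇ around-a | Around⇒aroundᵇ around-b with () ← bad≡false

  no-two-simple : ∀ {i j} → SimpleAt n D i → SimpleAt n D j → next n (next n i) ≡ j → ⊥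
  no-two-simple {i} (i< , ici) (_ , icj) refl = proj₂ mono (i , i< , ici , icj)

  Inside : ℕ → Set
  Inside p = a < p × p ≤ b

  Straddles : Chord → Set
  Straddles (x , y) = (Inside x × b < y) ⊎ (x ≤ a × Inside y)

  new-crosses : ∀ {x y} → Straddles (x , y) → Cross new (sh x , sh y)
  new-crosses (inj₁ ((a<x , x≤b) , b<y)) rewrite sh-mid a<x x≤b | sh-high b<y =
    inj₁ (s≤s a<x , s≤s (s≤s x≤b) , s≤s (s≤s b<y))
  new-crosses (inj₂ (x≤a , (a<y , y≤b))) rewrite sh-low x≤a | sh-mid a<y y≤b =
    inj₂ (s≤s x≤a , s≤s a<y , s≤s (s≤s y≤b))

  -- Follow the crossings back to the chord through endpoint 0, which has an end outside:
  -- a chord with both ends inside is only crossed by chords with an end inside.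
  straddling-root : ∀ {x y} → Root D (x , y) → Inside x ⊎ Inside y →
    Σ Chord λ e → Root D e × Straddles e
  straddling-root (base m (inj₁ refl)) (inj₁ (() , _))
  straddling-root r@(base m (inj₁ refl)) (inj₂ iy) = _ , r , inj₂ (z≤n , iy)
  straddling-root (base m (inj₂ refl)) _ = ⊥-elim (n≮0 (ordered M m))
  straddling-root {x} {y} r'@(step {u , v} r m cr) h = go h
    where
    x<y = ordered M m
    through : Cross (u , v) (x , y) → Inside x → Inside y → Σ Chord λ e → Root D e × Straddles e
    through (inj₁ (_ , x<v , v<y)) (a<x , _) (_ , y≤b) =
      straddling-root r (inj₂ (<-trans a<x x<v , ≤-trans (<⇒≤ v<y) y≤b))
    through (inj₂ (x<u , u<y , _)) (a<x , _) (_ , y≤b) =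
      straddling-root r (inj₁ (<-trans a<x x<u , ≤-trans (<⇒≤ u<y) y≤b))
    go : Inside x ⊎ Inside y → Σ Chord λ e → Root D e × Straddles e
    go (inj₁ ix) with y ≤? b
    ... | yes y≤b = through cr ix (<-trans (proj₁ ix) x<y , y≤b)
    ... | no y≰b  = _ , r' , inj₁ (ix , ≰⇒> y≰b)
    go (inj₂ iy) with x ≤? a
    ... | yes x≤a = _ , r' , inj₂ (x≤a , iy)
    ... | no x≰a  = through cr (≰⇒> x≰a , ≤-trans (<⇒≤ x<y) (proj₂ iy)) iy

  RootEndpoint : ℕ → Set
  RootEndpoint p = Σ Chord λ e → Root D e × (proj₁ e ≡ p ⊎ proj₂ e ≡ p)

  inside-root⇒new-root : ∀ {p} → Inside p → RootEndpoint p → Root D' new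
  inside-root⇒new-root ip ((x , y) , r , x≡p⊎y≡p)
    with (_ , _) , r' , s ← straddling-root r (Sum.map (λ { refl → ip }) (λ { refl → ip }) x≡p⊎y≡p)
    = step (Root-img r') new∈ (Cross-sym (new-crosses s))

  root-or-simple : ∀ p → p < n → RootEndpoint p ⊎ Σ ℕ λ i → SimpleAt n D i × (p ≡ i ⊎ p ≡ next n i)
  root-or-simple p p<n with covering M p p<n
  ... | q , inj₁ m with proj₁ mono (p , q) m
  ...   | inj₁ r = inj₁ (_ , r , inj₁ refl)
  ...   | inj₂ s with i , si , form ← SimpleIn⇒SimpleAt m s
                 = inj₂ (i , si , Sum.map proj₁ proj₂ form)
  root-or-simple p p<n | q , inj₂ m with proj₁ mono (q , p) m
  ...   | inj₁ r = inj₁ (_ , r , inj₂ refl)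
  ...   | inj₂ s with i , si , form ← SimpleIn⇒SimpleAt m s
                 = inj₂ (i , si , Sum.swap (Sum.map proj₂ proj₁ form))

  -- A simple chord ⟨j , j + 1⟩ next to an endpoint j + 2 inside the new chord: the chord through
  -- j + 2 is neither simple (partner conflict at j + 1, or two simple chords at distance 2)
  -- nor outside the root component, so it puts the new chord into the root component.
  beyond-simple : ∀ {j} → SimpleAt n D j → next n j ≡ suc j → Inside (suc (suc j)) → Root D' new
  beyond-simple {j} sj next-j inside with root-or-simple (suc (suc j)) (≤-<-trans (proj₂ inside) b<n)
  ... | inj₁ r = inside-root⇒new-root inside r
  ... | inj₂ (i , si , inj₁ refl) =
    ⊥-elim (no-two-simple sj si (trans (cong (next n) next-j) (next-suc n (suc j) (≤-<-trans (proj₂ inside) b<n))))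
  ... | inj₂ (i , si , inj₂ e) with refl ← next≡suc⇒≡ (proj₁ si) (sym e) =
    ⊥-elim (<-irrefl (sym (partner-unique M (subst (IsChord D (suc j)) (sym e) (proj₂ si))
                                            (subst (λ z → IsChord D z j) next-j (IsChord-sym (proj₂ sj)))))
                     (m<n+m j {2} (s≤s z≤n)))

  new-root : a < b → Root D' new
  new-root a<b with root-or-simple (suc a) (≤-<-trans a<b b<n)
  ... | inj₁ r = inside-root⇒new-root (n<1+n a , a<b) r
  ... | inj₂ (_ , si , inj₁ refl) with suc (suc (suc a)) ≤? b
  ...   | yes a+3≤b = beyond-simple si (next-suc n (suc a) (≤-<-trans (≤-trans (n≤1+n _) a+3≤b) b<n))
                                     (m<n+m a {3} (s≤s z≤n) , a+3≤b)
  ...   | no a+3≰b with b ≟ suc a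
  ...     | yes refl = ⊥-elim (not-near si (inj₁ refl) (inj₂ (inj₁ refl)))
  ...     | no b≢a+1 =
    ⊥-elim (not-near si (inj₁ refl) (inj₂ (inj₂ (trans b≡a+2 (sym (next-suc n (suc a) (subst (_< n) b≡a+2 b<n)))))))
    where b≡a+2 = ≤-antisym (≤-pred (≰⇒> a+3≰b)) (≤∧≢⇒< a<b (≢-sym b≢a+1))
  new-root a<b | inj₂ (i , si , inj₂ e) with refl ← next≡suc⇒≡ (proj₁ si) (sym e) with suc (suc a) ≤? b
  ... | yes a+2≤b = beyond-simple si (sym e) (m<n+m a {2} (s≤s z≤n) , a+2≤b)
  ... | no a+2≰b  = ⊥-elim (not-near si (inj₂ (inj₁ refl)) (inj₂ (inj₂ (trans b≡a+1 e))))
    where b≡a+1 = ≤-antisym (≤-pred (≰⇒> a+2≰b)) a<b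

  n'≡ : n' ≡ suc (suc n)
  n'≡ = *-suc 2 k

  sh<n' : ∀ {j} → j < n → sh j < n'
  sh<n' {j} p = subst (sh j <_) (sym n'≡) (≤-<-trans (sh-≤ j) (s<s (s<s p)))

  -- An old simple chord stays simple unless the new chord has an end in the arc it spans;
  -- then it crosses the new chord, which lies in the root component.
  Simple-img : ∀ {x y} → (x , y) ∈ D → SimpleIn n (x , y) → Root D' (sh x , sh y) ⊎ SimpleIn n' (sh x , sh y)
  Simple-img {x} {y} m s with SimpleIn⇒SimpleAt m s
  ... | i , si , form with next-view n i (proj₁ si) | form
  ...   | inj₁ (_ , e) | inj₂ (refl , e') = ⊥-elim (<-asym (ordered M m) (subst (y <_) (sym (trans e' e)) (n<1+n y)))
  ...   | inj₂ (_ , e) | inj₁ (refl , e') = ⊥-elim (n≮0 (subst (x <_) (trans e' e) (ordered M m)))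
  ...   | inj₁ (i+1<n , e) | inj₁ (refl , e') rewrite trans e' e with a ≟ i | b ≟ i
  ...     | yes refl | yes refl = ⊥-elim (not-near si (inj₂ (inj₁ refl)) (inj₂ (inj₁ refl)))
  ...     | yes refl | no b≢i =
    inj₁ (step (new-root a<b) (img∈ m) (new-crosses (inj₂ (≤-refl , (n<1+n a , a<b)))))
    where a<b = ≤∧≢⇒< a≤b (≢-sym b≢i)
  ...     | no a≢i | yes refl =
    inj₁ (step (new-root a<b) (img∈ m) (new-crosses (inj₁ ((a<b , ≤-refl) , n<1+n b))))
    where a<b = ≤∧≢⇒< a≤b a≢i
  ...     | no a≢i | no b≢i =
    inj₂ (sh i , sh<n' (<-trans (n<1+n i) i+1<n) ,
          inj₁ (refl , trans (sh-suc a≢i b≢i) (sym (next-suc n' (sh i) (subst (_< n') (sh-suc a≢i b≢i) (sh<n' i+1<n))))))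
  Simple-img {x} {y} m s | i , si , form | inj₂ (i+1≡n , e) | inj₂ (refl , e') rewrite trans e' e with a ≟ i | b ≟ i
  ...     | yes refl | yes refl = ⊥-elim (not-near si (inj₂ (inj₁ refl)) (inj₂ (inj₁ refl)))
  ...     | yes refl | no b≢i = ⊥-elim (b≢i (≤-antisym (≤-pred (subst (b <_) (sym i+1≡n) b<n)) a≤b))
  ...     | no a≢i | yes refl = inj₁ (step (new-root a<b) (img∈ m) (new-crosses (inj₂ (z≤n , (a<b , ≤-refl)))))
    where a<b = ≤∧≢⇒< a≤b a≢i
  ...     | no a≢i | no b≢i
    rewrite sh-0 | sh-high (≤∧≢⇒< (≤-pred (subst (b <_) (sym i+1≡n) b<n)) b≢i) =
    inj₂ (suc (suc i) , i+3≤n' , inj₂ (refl , sym (next-last n' (suc (suc i)) (trans (cong (2 +_) i+1≡n) (sym n'≡)))))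
    where i+3≤n' = subst (suc (suc i) <_) (sym n'≡) (s<s (s<s (subst (i <_) i+1≡n (n<1+n i))))

  a+2<n' : suc (suc a) < n'
  a+2<n' = subst (suc (suc a) <_) (sym n'≡) (s<s (s<s (≤-<-trans a≤b b<n)))

  next-sh-reflect : ∀ {x y} → x < n → y < n → next n' (sh x) ≡ sh y → next n x ≡ y
  next-sh-reflect {x} {y} x<n y<n e with next-view n' (sh x) (sh<n' x<n)
  ... | inj₁ (_ , e') with <-cmp x y
  ...   | tri> _ _ y<x = ⊥-elim (<-asym (sh-mono-< y<x) (subst (sh x <_) (trans (sym e') e) (n<1+n (sh x))))
  ...   | tri≈ _ refl _ = ⊥-elim (<-irrefl (sym (trans (sym e') e)) (n<1+n (sh x)))
  ...   | tri< x<y _ _ with suc x ≟ y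
  ...     | yes refl = next-suc n x y<n
  ...     | no x+1≢y = ⊥-elim (<-irrefl refl (≤-<-trans (sh-mono-< (n<1+n x))
                               (subst (sh (suc x) <_) (trans (sym e) e') (sh-mono-< (≤∧≢⇒< x<y x+1≢y)))))
  next-sh-reflect {x} {y} x<n y<n e | inj₂ (1+sh-x≡n' , e') = trans (next-last n x x+1≡n) (sym y≡0)
    where
    y≡0 = n≤0⇒n≡0 (subst (y ≤_) (trans (sym e) e') (sh-≥ y))
    x+1≡n = ≤-antisym x<n (≤-pred (≤-pred (subst (_≤ 3 + x) (trans 1+sh-x≡n' n'≡) (s≤s (sh-≤ x)))))

  new-start : ∀ {p} → p < n' → (p ≡ suc a × next n' p ≡ suc (suc b)) ⊎ (next n' p ≡ suc a × p ≡ suc (suc b)) →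
    p ≡ suc a × a ≡ b
  new-start p< (inj₁ (refl , e)) with next-view n' (suc a) p<
  ... | inj₁ (_ , e') = refl , suc-injective (suc-injective (trans (sym e') e))
  ... | inj₂ (_ , e') with () ← trans (sym e') e
  new-start p< (inj₂ (e , refl)) with next-view n' (suc (suc b)) p<
  ... | inj₁ (_ , e') = ⊥-elim (<-irrefl (sym (suc-injective (trans (sym e') e))) (s≤s (m≤n⇒m≤1+n a≤b)))
  ... | inj₂ (_ , e') with () ← trans (sym e') e

  SimpleAt-grow⁻ : ∀ {j} → SimpleAt n' D' j →
    (j ≡ suc a × a ≡ b) ⊎ Σ ℕ λ x → SimpleAt n D x × sh x ≡ j × sh (next n x) ≡ next n' j
  SimpleAt-grow⁻ (j< , ic) with IsChord-grow⁻ ic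
  ... | inj₁ h = inj₁ (new-start j< (inj₁ h))
  ... | inj₂ (inj₁ h) = inj₁ (new-start j< (inj₂ h))
  ... | inj₂ (inj₂ (x , y , icD , refl , e)) with x<n , y<n ← IsChord-bounded M icD =
    inj₂ (x , (x<n , subst (IsChord D x) (sym x→y) icD) , refl , trans (cong sh x→y) (sym e))
    where x→y = next-sh-reflect x<n y<n e

  next-after-new : ∀ {x} → next n' (suc (suc b)) ≡ sh x → next n b ≡ x
  next-after-new {x} e with next-view n' (suc (suc b)) (subst (suc (suc b) <_) (sym n'≡) (s<s (s<s b<n)))
  ... | inj₁ (b+3<n' , e') =
    trans (next-suc n b b+1<n) (sh-injective (trans (sh-high (n<1+n b)) (trans (sym e') e)))
    where b+1<n = ≤-pred (≤-pred (subst (3 + b <_) n'≡ b+3<n'))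
  ... | inj₂ (b+3≡n' , e') =
    trans (next-last n b (suc-injective (suc-injective (trans b+3≡n' n'≡))))
          (sym (n≤0⇒n≡0 (subst (x ≤_) (trans (sym e) e') (sh-≥ x))))

  before-new : ∀ {y} → y < n → next n' (sh y) ≡ suc a → y ≡ a
  before-new y<n e = sh-injective (trans (next≡suc⇒≡ (sh<n' y<n) e) (sym (sh-low ≤-refl)))

  no-two-simple-grow : ¬ TwoSimpleIn n' D'
  no-two-simple-grow (j , j< , ic₁ , ic₂)
    with SimpleAt-grow⁻ (j< , ic₁) | SimpleAt-grow⁻ (next-< n' _ (next-< n' j j<) , ic₂)
  ... | inj₁ (refl , refl) | inj₁ (e , _) rewrite next-suc n' (suc a) a+2<n'
    with next-view n' (suc (suc a)) a+2<n'
  ...   | inj₁ (_ , e') = <-irrefl (trans (sym e) e') (m<n+m (suc a) {2} (s≤s z≤n))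
  ...   | inj₂ (_ , e') with () ← trans (sym e) e'
  no-two-simple-grow (_ , _ , _ , _) | inj₁ (refl , refl) | inj₂ (x₂ , s₂ , e , _)
    rewrite next-suc n' (suc a) a+2<n' = not-near s₂ (inj₁ (sym prev≡a)) (inj₁ (sym prev≡a))
    where prev≡a = trans (cong (prev n) (sym (next-after-new {x₂} (sym e)))) (prev-next n a (≤-<-trans a≤b b<n))
  no-two-simple-grow (_ , _ , _ , _) | inj₂ (x₁ , s₁ , _ , e₂) | inj₁ (e , refl) = not-near s₁ around around
    where around = inj₂ (inj₂ (sym (before-new (next-< n x₁ (proj₁ s₁)) (trans (cong (next n') e₂) e))))
  no-two-simple-grow (_ , _ , _ , _) | inj₂ (x₁ , s₁ , _ , e₂) | inj₂ (x₂ , s₂ , e₃ , _) =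
    no-two-simple s₁ s₂ (next-sh-reflect (next-< n x₁ (proj₁ s₁)) (proj₁ s₂) (trans (cong (next n') e₂) (sym e₃)))

  monolithicIn-grow : MonolithicIn n' D'
  monolithicIn-grow = chords , no-two-simple-grow
    where
    chords : ∀ c → c ∈ D' → Root D' c ⊎ SimpleIn n' c
    chords c m with ∈-grow⁻ m
    ... | inj₁ refl with a ≟ b
    ...   | yes refl = inj₂ (suc a , <-trans (n<1+n (suc a)) a+2<n' , inj₁ (refl , sym (next-suc n' (suc a) a+2<n')))
    ...   | no a≢b   = inj₁ (new-root (≤∧≢⇒< a≤b a≢b))
    chords c m | inj₂ (x , y , m' , refl) with proj₁ mono (x , y) m'
    ...   | inj₁ r = inj₁ (Root-img r)
    ...   | inj₂ s = Simple-img m' s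

monolithic-grow : ∀ {k D a b} → IsMatching k D → 2 ≤ k → a ≤ b → b < 2 * k →
  badChoiceᵇ (points D) D (a , b) ≡ false → Monolithic D → Monolithic (grow (a , b) D)
monolithic-grow {k} {D} {a} {b} M k≥2 a≤b b<2k good mono =
  In⇒Monolithic D' (subst (λ z → MonolithicIn z D') (sym (points≡ M')) (GrowMonolithic.monolithicIn-grow
    a b a≤b D k M k≥2 b<2k (subst (λ z → MonolithicIn z D) (points≡ M) (Monolithic⇒In D mono))
    (subst (λ z → badChoiceᵇ z D (a , b) ≡ false) (points≡ M) good)))
  where
  D' = grow (a , b) D
  M' = Grow.isMatching-grow a b a≤b D M b<2k

#eq : ℕ → ℕ → ℕ
#eq i m = ∑ (upTo m) (λ a → iverson (a ≡ᵇ i))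

#ne : ℕ → ℕ → ℕ
#ne i m = ∑ (upTo m) (λ a → iverson (not (a ≡ᵇ i)))

iverson-not : ∀ x → iverson (not x) + iverson x ≡ 1
iverson-not true  = refl
iverson-not false = refl

iverson-∧ : ∀ x y → iverson (x ∧ y) ≡ iverson x * iverson y
iverson-∧ true  y = sym (+-identityʳ (iverson y))
iverson-∧ false y = refl

iverson-∨ : ∀ x y → iverson (x ∨ y) ≤ iverson x + iverson y
iverson-∨ true  y = s≤s z≤n
iverson-∨ false y = ≤-refl

#eq-below : ∀ i m → m ≤ i → #eq i m ≡ 0
#eq-below i zero    p = refl
#eq-below i (suc m) p
  rewrite ∑-upTo-suc m (λ a → iverson (a ≡ᵇ i)) | #eq-below i m (≤-trans (n≤1+n m) p)
        | ≢⇒≡ᵇ≡false {m} {i} (λ e → <-irrefl e p) = refl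

#eq-above : ∀ i m → i < m → #eq i m ≡ 1
#eq-above i (suc m) p rewrite ∑-upTo-suc m (λ a → iverson (a ≡ᵇ i)) with m ≟ i
... | yes refl rewrite #eq-below m m ≤-refl | ≡ᵇ-refl m = refl
... | no m≢i rewrite #eq-above i m (≤∧≢⇒< (≤-pred p) (≢-sym m≢i)) | ≢⇒≡ᵇ≡false m≢i = refl

#eq≤1 : ∀ i m → #eq i m ≤ 1
#eq≤1 i m with m ≤? i
... | yes p rewrite #eq-below i m p = z≤n
... | no p  rewrite #eq-above i m (≰⇒> p) = ≤-refl

#ne+#eq : ∀ i m → #ne i m + #eq i m ≡ m
#ne+#eq i m = begin
  #ne i m + #eq i m                                            ≡⟨ sym (∑-+ (upTo m) _ _) ⟩
  ∑ (upTo m) (λ a → iverson (not (a ≡ᵇ i)) + iverson (a ≡ᵇ i)) ≡⟨ ∑-cong (upTo m) (λ a _ → iverson-not (a ≡ᵇ i)) ⟩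
  ∑ (upTo m) (λ _ → 1)                                         ≡⟨ ∑-length (upTo m) ⟩
  length (upTo m)                                              ≡⟨ length-upTo m ⟩
  m                                                            ∎
  where open ≡-Reasoning

#ne-below : ∀ i m → m ≤ i → #ne i m ≡ m
#ne-below i m p = trans (sym (+-identityʳ _)) (trans (cong (#ne i m +_) (sym (#eq-below i m p))) (#ne+#eq i m))

#ne-above : ∀ i m → i < suc m → #ne i (suc m) ≡ m
#ne-above i m p = +-cancelʳ-≡ 1 _ m (trans (cong (#ne i (suc m) +_) (sym (#eq-above i (suc m) p)))
                                           (trans (#ne+#eq i (suc m)) (+-comm 1 m)))

aroundᵇ-count : ∀ n i m → ∑ (upTo m) (λ z → iverson (aroundᵇ n i z)) ≤ 3
aroundᵇ-count n i m = begin
  ∑ (upTo m) (λ z → iverson (aroundᵇ n i z))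
    ≤⟨ ∑-upTo-mono-≤ m (λ z _ → split z) ⟩
  ∑ (upTo m) (λ z → iverson (z ≡ᵇ prev n i) + (iverson (z ≡ᵇ i) + iverson (z ≡ᵇ next n i)))
    ≡⟨ trans (∑-+ (upTo m) _ _) (cong (#eq (prev n i) m +_) (∑-+ (upTo m) _ _)) ⟩
  #eq (prev n i) m + (#eq i m + #eq (next n i) m)
    ≤⟨ +-mono-≤ (#eq≤1 _ m) (+-mono-≤ (#eq≤1 _ m) (#eq≤1 _ m)) ⟩
  3 ∎
  where
  open ≤-Reasoning
  split : ∀ z → iverson (aroundᵇ n i z) ≤ iverson (z ≡ᵇ prev n i) + (iverson (z ≡ᵇ i) + iverson (z ≡ᵇ next n i))
  split z = ≤-trans (iverson-∨ (z ≡ᵇ prev n i) _) (+-monoʳ-≤ _ (iverson-∨ (z ≡ᵇ i) _))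

near-count : ∀ k n i → ∑ (allChoices k) (λ c → iverson (nearᵇ n i c)) ≤ 9
near-count k n i = begin
  ∑ (allChoices k) (λ c → iverson (nearᵇ n i c))
    ≡⟨ ∑-allChoices k _ ⟩
  ∑ (upTo (2 * k)) (λ b → ∑ (upTo (suc b)) (λ a → iverson (around a ∧ around b)))
    ≡⟨ ∑-upTo-cong (2 * k) (λ b _ → trans (∑-cong (upTo (suc b)) (λ a _ →
          trans (iverson-∧ (around a) (around b)) (*-comm (iverson (around a)) _)))
          (∑-*ˡ (upTo (suc b)) (iverson (around b)) _)) ⟩
  ∑ (upTo (2 * k)) (λ b → iverson (around b) * ∑ (upTo (suc b)) (λ a → iverson (around a)))
    ≤⟨ ∑-upTo-mono-≤ (2 * k) (λ b _ → *-monoʳ-≤ (iverson (around b)) (aroundᵇ-count n i (suc b))) ⟩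
  ∑ (upTo (2 * k)) (λ b → iverson (around b) * 3)
    ≡⟨ ∑-*ʳ (upTo (2 * k)) _ 3 ⟩
  ∑ (upTo (2 * k)) (λ b → iverson (around b)) * 3
    ≤⟨ *-monoˡ-≤ 3 (aroundᵇ-count n i (2 * k)) ⟩
  9 ∎
  where
  open ≤-Reasoning
  around = aroundᵇ n i

#simple : ℕ → Diagram → ℕ
#simple n D = ∑ D (λ e → iverson (isSimpleᵇ n e))

bad-count : ∀ k n D → ∑ (allChoices k) (λ c → iverson (badChoiceᵇ n D c)) ≤ 9 * #simple n D
bad-count k n D = begin
  ∑ (allChoices k) (λ c → iverson (badChoiceᵇ n D c))
    ≤⟨ ∑-mono-≤ (allChoices k) (λ c _ → iverson-any≤ _ D) ⟩
  ∑ (allChoices k) (λ c → ∑ D (λ e → iverson (isSimpleᵇ n e ∧ nearᵇ n (simpleStart n e) c)))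
    ≡⟨ ∑-swap (allChoices k) D _ ⟩
  ∑ D (λ e → ∑ (allChoices k) (λ c → iverson (isSimpleᵇ n e ∧ nearᵇ n (simpleStart n e) c)))
    ≡⟨ ∑-cong D (λ e _ → trans (∑-cong (allChoices k) (λ c _ → iverson-∧ (isSimpleᵇ n e) _))
                               (∑-*ˡ (allChoices k) (iverson (isSimpleᵇ n e)) _)) ⟩
  ∑ D (λ e → iverson (isSimpleᵇ n e) * ∑ (allChoices k) (λ c → iverson (nearᵇ n (simpleStart n e) c)))
    ≤⟨ ∑-mono-≤ D (λ e _ → *-monoʳ-≤ (iverson (isSimpleᵇ n e)) (near-count k n (simpleStart n e))) ⟩
  ∑ D (λ e → iverson (isSimpleᵇ n e) * 9)
    ≡⟨ trans (∑-*ʳ D (λ e → iverson (isSimpleᵇ n e)) 9) (*-comm (#simple n D) 9) ⟩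
  9 * #simple n D ∎
  where open ≤-Reasoning

module ShiftSimple (a b : ℕ) (a≤b : a ≤ b) where

  open Shift a b a≤b

  Simple-img⁻ : ∀ n {x y} → 4 ≤ n → x < y → y < n → isSimpleᵇ (suc (suc n)) (sh x , sh y) ≡ true →
    isSimpleᵇ n (x , y) ≡ true × a ≢ simpleStart n (x , y) × b ≢ simpleStart n (x , y)
  Simple-img⁻ n {x} {y} n≥4 x<y y<n h with isSimpleᵇ≡true⇒ {suc (suc n)} {sh x} {sh y} h
  ... | inj₁ e with a ≟ x
  ...   | yes refl = ⊥-elim (<-irrefl (trans (cong suc (sym (sh-low {x} ≤-refl))) e) (<-≤-trans (s<s x<y) (sh-> {y} x<y)))
  ...   | no a≢x with b ≟ x
  ...     | yes refl = ⊥-elim (<-irrefl (suc-injective (suc-injective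
                          (trans (cong suc (sym (sh-mid (≤∧≢⇒< a≤b a≢x) ≤-refl))) (trans e (sh-high x<y))))) x<y)
  ...     | no b≢x with refl ← sh-injective {y} {suc x} (trans (sym e) (sym (sh-suc a≢x b≢x)))
    rewrite ≡ᵇ-refl x = refl , a≢x , b≢x
  Simple-img⁻ n {x} {y} n≥4 x<y y<n h | inj₂ (sh-x≡0 , sh-y+1≡n+2)
    with refl ← n≤0⇒n≡0 (subst (x ≤_) sh-x≡0 (sh-≥ x)) with shift-view a b y a≤b
  ... | inj₁ (_ , e) = ⊥-elim (<-irrefl (trans (sym e) (suc-injective sh-y+1≡n+2)) (m<n⇒m<1+n y<n))
  ... | inj₂ (inj₁ (_ , _ , e)) = ⊥-elim (<-irrefl (suc-injective (trans (sym e) (suc-injective sh-y+1≡n+2))) y<n)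
  ... | inj₂ (inj₂ (b<y , e)) =
    let simple , start = wrap-simple 1≢y y+1≡n in
    simple , (λ a≡ → <-irrefl (trans a≡ start) (≤-<-trans a≤b b<y)) , (λ b≡ → <-irrefl (trans b≡ start) b<y)
    where
    y+1≡n = suc-injective (trans (sym e) (suc-injective sh-y+1≡n+2))
    1≢y : 1 ≢ y
    1≢y refl = <-irrefl y+1≡n (≤-trans (n≤1+n 3) n≥4)

#avoiding : ℕ → ℕ → ℕ
#avoiding i n = ∑ (upTo n) (λ b → iverson (not (b ≡ᵇ i)) * #ne i (suc b))

≢⇒iverson-not≡1 : ∀ {m n} → m ≢ n → iverson (not (m ≡ᵇ n)) ≡ 1
≢⇒iverson-not≡1 m≢n rewrite ≢⇒≡ᵇ≡false m≢n = refl

#avoiding-below : ∀ i n → n ≤ i → #avoiding i n ≡ ∑ (upTo n) suc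
#avoiding-below i n n≤i = ∑-upTo-cong n (λ b b<n → begin
  iverson (not (b ≡ᵇ i)) * #ne i (suc b)   ≡⟨ cong (_* #ne i (suc b)) (≢⇒iverson-not≡1 (λ e → <-irrefl e (<-≤-trans b<n n≤i))) ⟩
  1 * #ne i (suc b)                        ≡⟨ *-identityˡ _ ⟩
  #ne i (suc b)                            ≡⟨ #ne-below i (suc b) (<-≤-trans b<n n≤i) ⟩
  suc b                                    ∎)
  where open ≡-Reasoning

#avoiding+n : ∀ i n → i < n → #avoiding i n + n ≡ ∑ (upTo n) suc
#avoiding+n i (suc m) i<1+m rewrite ∑-upTo-suc m (λ b → iverson (not (b ≡ᵇ i)) * #ne i (suc b))
                                  | ∑-upTo-suc m suc with m ≟ i
... | yes refl rewrite ≡ᵇ-refl m | +-identityʳ (#avoiding m m) = cong (_+ suc m) (#avoiding-below m m ≤-refl)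
... | no m≢i rewrite ≢⇒iverson-not≡1 m≢i | *-identityˡ (#ne i (suc m)) | #ne-above i m i<1+m = begin
  #avoiding i m + m + suc m     ≡⟨ cong (_+ suc m) (#avoiding+n i m (≤∧≢⇒< (≤-pred i<1+m) (≢-sym m≢i))) ⟩
  ∑ (upTo m) suc + suc m        ∎
  where open ≡-Reasoning

∑∑-avoiding : ∀ i n →
  ∑ (upTo n) (λ b → ∑ (upTo (suc b)) (λ a → iverson (not (a ≡ᵇ i)) * iverson (not (b ≡ᵇ i)))) ≡ #avoiding i n
∑∑-avoiding i n = ∑-upTo-cong n (λ b _ →
  trans (∑-*ʳ (upTo (suc b)) (λ a → iverson (not (a ≡ᵇ i))) _) (*-comm (#ne i (suc b)) _))

new-simple⇒a≡b : ∀ n a b → iverson (isSimpleᵇ n (suc a , b + 2)) ≤ iverson (a ≡ᵇ b)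
new-simple⇒a≡b n a b with isSimpleᵇ n (suc a , b + 2) in e
... | false = z≤n
... | true with isSimpleᵇ≡true⇒ {n} {suc a} {b + 2} e
...   | inj₁ a+2≡b+2 rewrite suc-injective (suc-injective (trans a+2≡b+2 (+-comm b 2))) | ≡ᵇ-refl b = ≤-refl

simpleImg : ℕ → Choice → Chord → ℕ
simpleImg n (a , b) (x , y) = iverson (isSimpleᵇ n (shift a b x , shift a b y))

module SimpleRecurrence (k : ℕ) (D : Diagram) (M : IsMatching k D) (k≥2 : 2 ≤ k) where

  n n' : ℕ
  n  = 2 * k
  n' = 2 * suc k

  new-simple-count : ∑ (allChoices k) (λ c → iverson (isSimpleᵇ n' (suc (proj₁ c) , proj₂ c + 2))) ≤ n
  new-simple-count = begin
    ∑ (allChoices k) (λ c → iverson (isSimpleᵇ n' (suc (proj₁ c) , proj₂ c + 2)))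
      ≡⟨ ∑-allChoices k _ ⟩
    ∑ (upTo n) (λ b → ∑ (upTo (suc b)) (λ a → iverson (isSimpleᵇ n' (suc a , b + 2))))
      ≤⟨ ∑-upTo-mono-≤ n (λ b _ → ≤-trans (∑-upTo-mono-≤ (suc b) (λ a _ → new-simple⇒a≡b n' a b)) (#eq≤1 b (suc b))) ⟩
    ∑ (upTo n) (λ _ → 1)
      ≡⟨ trans (∑-length (upTo n)) (length-upTo n) ⟩
    n ∎
    where open ≤-Reasoning

  simpleImg≤ : ∀ {x y} → x < y → y < n → ∀ a b → a ≤ b →
    simpleImg n' (a , b) (x , y) ≤
    iverson (isSimpleᵇ n (x , y)) * (iverson (not (a ≡ᵇ simpleStart n (x , y))) * iverson (not (b ≡ᵇ simpleStart n (x , y))))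
  simpleImg≤ {x} {y} x<y y<n a b a≤b with isSimpleᵇ n' (shift a b x , shift a b y) in e
  ... | false = z≤n
  ... | true with simple , a≢ , b≢ ← ShiftSimple.Simple-img⁻ a b a≤b n (*-monoʳ-≤ 2 k≥2) x<y y<n
                                        (subst (λ z → isSimpleᵇ z (shift a b x , shift a b y) ≡ true) (*-suc 2 k) e)
    rewrite simple | ≢⇒iverson-not≡1 a≢ | ≢⇒iverson-not≡1 b≢ = ≤-refl

  -- A simple chord ⟨i , i + 1⟩ stays simple only for the #avoiding i n choices avoiding arc i,
  -- and #avoiding i n = #choices k - n.
  old-simple-count : ∀ {x y} → (x , y) ∈ D →
    ∑ (allChoices k) (λ c → simpleImg n' c (x , y)) + n * iverson (isSimpleᵇ n (x , y)) ≤
    iverson (isSimpleᵇ n (x , y)) * #choices k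
  old-simple-count {x} {y} m = begin
    ∑ (allChoices k) (λ c → simpleImg n' c (x , y)) + n * s
      ≡⟨ cong (_+ n * s) (∑-allChoices k _) ⟩
    ∑ (upTo n) (λ b → ∑ (upTo (suc b)) (λ a → simpleImg n' (a , b) (x , y))) + n * s
      ≤⟨ +-monoˡ-≤ _ (∑-upTo-mono-≤ n (λ b _ → ∑-upTo-mono-≤ (suc b) (λ a a≤b →
           simpleImg≤ (ordered M m) (bounded M m) a b (≤-pred a≤b)))) ⟩
    ∑ (upTo n) (λ b → ∑ (upTo (suc b)) (λ a → s * avoid a b)) + n * s
      ≡⟨ cong (_+ n * s) (trans (∑-upTo-cong n (λ b _ → ∑-*ˡ (upTo (suc b)) s _)) (∑-*ˡ (upTo n) s _)) ⟩
    s * ∑ (upTo n) (λ b → ∑ (upTo (suc b)) (λ a → avoid a b)) + n * s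
      ≡⟨ cong (λ z → s * z + n * s) (∑∑-avoiding i n) ⟩
    s * #avoiding i n + n * s
      ≡⟨ cong (s * #avoiding i n +_) (*-comm n s) ⟩
    s * #avoiding i n + s * n
      ≡⟨ sym (*-distribˡ-+ s (#avoiding i n) n) ⟩
    s * (#avoiding i n + n)
      ≡⟨ cong (s *_) (trans (#avoiding+n i n i<n) (sym (#choices≡∑suc k))) ⟩
    s * #choices k ∎
    where
    open ≤-Reasoning
    s = iverson (isSimpleᵇ n (x , y))
    i = simpleStart n (x , y)
    avoid : ℕ → ℕ → ℕ
    avoid a b = iverson (not (a ≡ᵇ i)) * iverson (not (b ≡ᵇ i))
    i<n : i < n
    i<n with suc x ≡ᵇ y
    ... | true  = <-trans (ordered M m) (bounded M m)
    ... | false = bounded M m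

  #simple-grow : ∑ (allChoices k) (λ c → #simple n' (grow c D)) + n * #simple n D ≤ n + #simple n D * #choices k
  #simple-grow = begin
    ∑ (allChoices k) (λ c → #simple n' (grow c D)) + n * #simple n D
      ≡⟨ cong (_+ n * #simple n D) (trans (∑-cong (allChoices k) (λ c _ → cong (new c +_) (∑-map _ D _)))
                                          (∑-+ (allChoices k) new _)) ⟩
    ∑ (allChoices k) new + ∑ (allChoices k) (λ c → ∑ D (simpleImg n' c)) + n * #simple n D
      ≡⟨ +-assoc (∑ (allChoices k) new) _ _ ⟩
    ∑ (allChoices k) new + (∑ (allChoices k) (λ c → ∑ D (simpleImg n' c)) + n * #simple n D)
      ≤⟨ +-mono-≤ new-simple-count (≤-reflexive (cong₂ _+_ (∑-swap (allChoices k) D (simpleImg n'))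
                                                          (sym (∑-*ˡ D n _)))) ⟩
    n + (∑ D (λ e → ∑ (allChoices k) (λ c → simpleImg n' c e)) + ∑ D (λ e → n * iverson (isSimpleᵇ n e)))
      ≡⟨ cong (n +_) (sym (∑-+ D _ _)) ⟩
    n + ∑ D (λ e → ∑ (allChoices k) (λ c → simpleImg n' c e) + n * iverson (isSimpleᵇ n e))
      ≤⟨ +-monoʳ-≤ n (∑-mono-≤ D (λ _ m → old-simple-count m)) ⟩
    n + ∑ D (λ e → iverson (isSimpleᵇ n e) * #choices k)
      ≡⟨ cong (n +_) (∑-*ʳ D _ (#choices k)) ⟩
    n + #simple n D * #choices k ∎
    where
    open ≤-Reasoning
    new : Choice → ℕ
    new c = iverson (isSimpleᵇ n' (suc (proj₁ c) , proj₂ c + 2))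

badStepᵇ : Diagram → ℕ → List Choice → Bool
badStepᵇ D _       []       = false
badStepᵇ D zero    (c ∷ cs) = badChoiceᵇ (points D) D c
badStepᵇ D (suc j) (c ∷ cs) = badStepᵇ (grow c D) j cs

isMatching-build : ∀ {k cs D} → WellFormed k cs → IsMatching k D → IsMatching (k + length cs) (build cs D)
isMatching-build {k} {[]}               []               M rewrite +-identityʳ k = M
isMatching-build {k} {(a , b) ∷ cs} {D} ((a≤b , b<) ∷ wf) M rewrite +-suc k (length cs) =
  isMatching-build wf (Grow.isMatching-grow a b a≤b D M b<)

isMatching-seq : ∀ {k n cs D} → cs ∈ seqsFrom k n → IsMatching k D → IsMatching (k + n) (build cs D)
isMatching-seq {k} {n} m M with wf , refl ← ∈-seqsFrom⁻ k n m = isMatching-build wf M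

good-step-monolithic : ∀ j {k D cs} → IsMatching k D → WellFormed k cs → 2 ≤ k + j → j < length cs →
  badStepᵇ D j cs ≡ false → Monolithic (build (take j cs) D) → Monolithic (build (take (suc j) cs) D)
good-step-monolithic zero {k} {D} {(a , b) ∷ cs} M ((a≤b , b<) ∷ _) k≥2 _ good =
  monolithic-grow M (subst (2 ≤_) (+-identityʳ k) k≥2) a≤b b< good
good-step-monolithic (suc j) {k} {D} {(a , b) ∷ cs} M ((a≤b , b<) ∷ wf) k+j≥2 (s≤s j<) good =
  good-step-monolithic j (Grow.isMatching-grow a b a≤b D M b<) wf (subst (2 ≤_) (+-suc k j) k+j≥2) j< good

switch⇒badStep : ∀ {n m cs} → cs ∈ allSeqs n → 2 ≤ m → m ≤ n → Switch cs m → badStepᵇ U₁ (pred m) cs ≡ true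
switch⇒badStep {n} {suc j} {cs} cs∈ (s≤s 1≤j) m≤n (mono , not-mono) with badStepᵇ U₁ j cs in e
... | true  = refl
... | false with wf , refl ← ∈-seqsFrom⁻ 1 n cs∈ =
  ⊥-elim (not-mono (good-step-monolithic j isMatching-U₁ wf (s≤s 1≤j) m≤n e mono))

length-filter-T : ∀ {A : Set} (f : A → Bool) xs → length (filter (λ x → T? (f x)) xs) ≡ ∑ xs (λ x → iverson (f x))
length-filter-T f []       = refl
length-filter-T f (x ∷ xs) with f x
... | true  = cong suc (length-filter-T f xs)
... | false = length-filter-T f xs

-- Summing over all continuations turns expectations into integer counts: simpleTotal k j D is
-- #seqs k j times the expected number of simple chords after j steps from D (which has k chords),
-- and #badStep k N D j counts the sequences of length N whose (j+1)-th choice is bad.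
simpleTotal : ℕ → ℕ → Diagram → ℕ
simpleTotal k j D = ∑ (seqsFrom k j) (λ cs → #simple (points (build cs D)) (build cs D))

#badStep : ℕ → ℕ → Diagram → ℕ → ℕ
#badStep k N D j = ∑ (seqsFrom k N) (λ cs → iverson (badStepᵇ D j cs))

#badStep≤ : ∀ j k r D → IsMatching k D →
  #badStep k (j + suc r) D j ≤ 9 * simpleTotal k j D * #seqs (suc (k + j)) r
#badStep≤ zero k r D M = begin
  #badStep k (suc r) D 0
    ≡⟨ ∑-seqsFrom-suc k r _ ⟩
  ∑ (allChoices k) (λ c → ∑ (seqsFrom (suc k) r) (λ _ → iverson (badChoiceᵇ (points D) D c)))
    ≡⟨ ∑-cong (allChoices k) (λ c _ → trans (∑-const (seqsFrom (suc k) r) _) (*-comm (#seqs (suc k) r) _)) ⟩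
  ∑ (allChoices k) (λ c → iverson (badChoiceᵇ (points D) D c) * #seqs (suc k) r)
    ≡⟨ ∑-*ʳ (allChoices k) _ _ ⟩
  ∑ (allChoices k) (λ c → iverson (badChoiceᵇ (points D) D c)) * #seqs (suc k) r
    ≤⟨ *-monoˡ-≤ (#seqs (suc k) r) (bad-count k (points D) D) ⟩
  9 * #simple (points D) D * #seqs (suc k) r
    ≡⟨ cong₂ (λ u v → 9 * u * #seqs (suc v) r) (sym (+-identityʳ (#simple (points D) D))) (sym (+-identityʳ k)) ⟩
  9 * simpleTotal k 0 D * #seqs (suc (k + 0)) r ∎
  where open ≤-Reasoning
#badStep≤ (suc j) k r D M = begin
  #badStep k (suc (j + suc r)) D (suc j)
    ≡⟨ ∑-seqsFrom-suc k (j + suc r) _ ⟩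
  ∑ (allChoices k) (λ c → #badStep (suc k) (j + suc r) (grow c D) j)
    ≤⟨ ∑-mono-≤ (allChoices k) after-first ⟩
  ∑ (allChoices k) (λ c → 9 * simpleTotal (suc k) j (grow c D) * #seqs (suc (suc k + j)) r)
    ≡⟨ ∑-*ʳ (allChoices k) _ _ ⟩
  ∑ (allChoices k) (λ c → 9 * simpleTotal (suc k) j (grow c D)) * #seqs (suc (suc k + j)) r
    ≡⟨ cong₂ _*_ (∑-*ˡ (allChoices k) 9 _) (cong (λ z → #seqs (suc z) r) (sym (+-suc k j))) ⟩
  9 * ∑ (allChoices k) (λ c → simpleTotal (suc k) j (grow c D)) * #seqs (suc (k + suc j)) r
    ≡⟨ cong (λ z → 9 * z * #seqs (suc (k + suc j)) r) (sym (∑-seqsFrom-suc k j _)) ⟩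
  9 * simpleTotal k (suc j) D * #seqs (suc (k + suc j)) r ∎
  where
  open ≤-Reasoning
  after-first : ∀ c → c ∈ allChoices k →
    #badStep (suc k) (j + suc r) (grow c D) j ≤ 9 * simpleTotal (suc k) j (grow c D) * #seqs (suc (suc k + j)) r
  after-first (a , b) c∈ with a≤b , b< ← ∈-allChoices⁻ k c∈ =
    #badStep≤ j (suc k) r (grow (a , b) D) (Grow.isMatching-grow a b a≤b D M b<)

-- If an average P/T ≤ 2 evolves by X/(TC) ≤ (1 - K/C) P/T + K/C with K ≤ C, the new average is ≤ 2.
recurrence-≤2 : ∀ X P T K C → X + K * P ≤ K * T + P * C → P ≤ 2 * T → K ≤ C → X ≤ 2 * T * C
recurrence-≤2 X P T K C h P≤2T K≤C = begin
  X                           ≤⟨ +-cancelʳ-≤ (K * P) X (K * T + P * E) h' ⟩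
  K * T + P * E               ≤⟨ +-mono-≤ (*-monoʳ-≤ K (m≤n+m T T)) (*-monoˡ-≤ E P≤2T) ⟩
  K * (T + T) + 2 * T * E     ≡⟨ solve 3 (λ K T E → K :* (T :+ T) :+ (con 2 :* T) :* E := (con 2 :* T) :* (K :+ E)) refl K T E ⟩
  2 * T * (K + E)             ≡⟨ cong (2 * T *_) K+E≡C ⟩
  2 * T * C                   ∎
  where
  open ≤-Reasoning
  E = C ∸ K
  K+E≡C = m+[n∸m]≡n K≤C
  h' : X + K * P ≤ K * T + P * E + K * P
  h' = ≤-trans h (≤-reflexive (trans (cong (λ z → K * T + P * z) (sym K+E≡C))
         (solve 4 (λ K T P E → K :* T :+ P :* (K :+ E) := K :* T :+ P :* E :+ K :* P) refl K T P E)))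

points-grow : ∀ c D → points (grow c D) ≡ 2 * suc (length D)
points-grow (a , b) D = cong (λ z → 2 * suc z) (length-map _ D)

module _ (j : ℕ) where

  private
    k n C tot sim : ℕ
    k   = suc (suc j)
    n   = 2 * k
    C   = #choices k
    tot = #seqs 1 (suc j)
    sim = simpleTotal 1 (suc j) U₁

  simpleTotal-step : simpleTotal 1 (suc (suc j)) U₁ + n * sim ≤ n * tot + sim * C
  simpleTotal-step = begin
    simpleTotal 1 (suc (suc j)) U₁ + n * sim
      ≡⟨ cong₂ _+_ snoc (sym (∑-*ˡ (seqsFrom 1 (suc j)) n simple)) ⟩
    ∑ (seqsFrom 1 (suc j)) grown + ∑ (seqsFrom 1 (suc j)) (λ cs → n * simple cs)
      ≡⟨ sym (∑-+ (seqsFrom 1 (suc j)) _ _) ⟩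
    ∑ (seqsFrom 1 (suc j)) (λ cs → grown cs + n * simple cs)
      ≤⟨ ∑-mono-≤ (seqsFrom 1 (suc j)) one-step ⟩
    ∑ (seqsFrom 1 (suc j)) (λ cs → n + simple cs * C)
      ≡⟨ ∑-+ (seqsFrom 1 (suc j)) _ _ ⟩
    ∑ (seqsFrom 1 (suc j)) (λ _ → n) + ∑ (seqsFrom 1 (suc j)) (λ cs → simple cs * C)
      ≡⟨ cong₂ _+_ (trans (∑-const (seqsFrom 1 (suc j)) n) (*-comm tot n)) (∑-*ʳ (seqsFrom 1 (suc j)) _ C) ⟩
    n * tot + sim * C ∎
    where
    open ≤-Reasoning
    simple grown : List Choice → ℕ
    simple cs = #simple (points (build cs U₁)) (build cs U₁)
    grown cs = ∑ (allChoices k) (λ c → #simple (2 * suc k) (grow c (build cs U₁)))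
    matching : ∀ {cs} → cs ∈ seqsFrom 1 (suc j) → IsMatching k (build cs U₁)
    matching cs∈ = isMatching-seq cs∈ isMatching-U₁
    snoc : simpleTotal 1 (suc (suc j)) U₁ ≡ ∑ (seqsFrom 1 (suc j)) grown
    snoc = trans (∑-seqsFrom-snoc 1 (suc j) (λ cs → #simple (points (build cs U₁)) (build cs U₁)))
             (∑-cong (seqsFrom 1 (suc j)) (λ cs cs∈ → ∑-cong (allChoices k) (λ c _ →
               trans (cong (λ D → #simple (points D) D) (build-snoc cs c U₁))
                     (cong (λ z → #simple z (grow c (build cs U₁)))
                           (trans (points-grow c (build cs U₁)) (cong (λ z → 2 * suc z) (length≡ (matching cs∈))))))))
    one-step : ∀ cs → cs ∈ seqsFrom 1 (suc j) → grown cs + n * simple cs ≤ n + simple cs * C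
    one-step cs cs∈ rewrite points≡ (matching cs∈) =
      SimpleRecurrence.#simple-grow k (build cs U₁) (matching cs∈) (s≤s (s≤s z≤n))

simpleTotal≤ : ∀ j → simpleTotal 1 (suc j) U₁ ≤ 2 * #seqs 1 (suc j)
simpleTotal≤ zero    = s≤s (s≤s (s≤s (s≤s z≤n)))
simpleTotal≤ (suc j) = ≤-trans
  (recurrence-≤2 (simpleTotal 1 (suc (suc j)) U₁) (simpleTotal 1 (suc j) U₁) (#seqs 1 (suc j))
                 (2 * suc (suc j)) (#choices (suc (suc j))) (simpleTotal-step j) (simpleTotal≤ j) (2k≤#choices (suc (suc j))))
  (≤-reflexive (trans (*-assoc 2 (#seqs 1 (suc j)) (#choices (suc (suc j)))) (cong (2 *_) seqs≡)))
  where
  seqs≡ : #seqs 1 (suc j) * #choices (suc (suc j)) ≡ #seqs 1 (suc (suc j))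
  seqs≡ = sym (trans (cong (#seqs 1) (+-comm 1 (suc j)))
                     (trans (#seqs-+ 1 (suc j) 1) (cong (#seqs 1 (suc j) *_) (trans (#seqs-suc (suc (suc j)) 0) (*-identityʳ _)))))

-- The probability that the choice at step m + 1 is bad is at most 9 E[#simple] / #choices m ≤ 18 / (m (m + 1)).
#badStep-bound : ∀ M m → 2 ≤ m → m ≤ M → m * suc m * #badStep 1 M U₁ (pred m) ≤ 18 * #seqs 1 M
#badStep-bound M (suc zero) (s≤s ()) _
#badStep-bound M (suc (suc j)) _ m≤M = subst (λ N → m * suc m * #badStep 1 N U₁ (suc j) ≤ 18 * #seqs 1 N) j+1+r≡M (begin
  m * suc m * #badStep 1 (suc j + suc r) U₁ (suc j)
    ≤⟨ *-monoˡ-≤ (#badStep 1 (suc j + suc r) U₁ (suc j)) (k*[1+k]≤#choices m) ⟩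
  C * #badStep 1 (suc j + suc r) U₁ (suc j)
    ≤⟨ *-monoʳ-≤ C (#badStep≤ (suc j) 1 r U₁ isMatching-U₁) ⟩
  C * (9 * simpleTotal 1 (suc j) U₁ * #seqs (suc m) r)
    ≤⟨ *-monoʳ-≤ C (*-monoˡ-≤ (#seqs (suc m) r) (*-monoʳ-≤ 9 (simpleTotal≤ j))) ⟩
  C * (9 * (2 * #seqs 1 (suc j)) * #seqs (suc m) r)
    ≡⟨ solve 3 (λ C A B → C :* (con 9 :* (con 2 :* A) :* B) := con 18 :* (A :* (C :* B))) refl C (#seqs 1 (suc j)) (#seqs (suc m) r) ⟩
  18 * (#seqs 1 (suc j) * (C * #seqs (suc m) r))
    ≡⟨ cong (λ z → 18 * (#seqs 1 (suc j) * z)) (sym (#seqs-suc m r)) ⟩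
  18 * (#seqs 1 (suc j) * #seqs m (suc r))
    ≡⟨ cong (18 *_) (sym (#seqs-+ 1 (suc j) (suc r))) ⟩
  18 * #seqs 1 (suc j + suc r) ∎)
  where
  open ≤-Reasoning
  m = suc (suc j)
  C = #choices m
  r = M ∸ m
  j+1+r≡M : suc j + suc r ≡ M
  j+1+r≡M = trans (cong suc (+-suc j r)) (m+[n∸m]≡n m≤M)

interval : ℕ → ℕ → List ℕ
interval ω zero    = []
interval ω (suc g) = ω ∷ interval (suc ω) g

∈-interval⁺ : ∀ g {ω m} → ω ≤ m → m < ω + g → m ∈ interval ω g
∈-interval⁺ zero    {ω} ω≤m m<ω+0 = ⊥-elim (<⇒≱ (subst (_ <_) (+-identityʳ ω) m<ω+0) ω≤m)
∈-interval⁺ (suc g) {ω} {m} ω≤m m<ω+g with ω ≟ m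
... | yes refl = here refl
... | no ω≢m   = there (∈-interval⁺ g (≤∧≢⇒< ω≤m ω≢m) (subst (m <_) (+-suc ω g) m<ω+g))

-- Telescoping: 1 / (m (m + 1)) = 1 / m - 1 / (m + 1).
telescoping : ∀ (f : ℕ → ℕ) B g ω → (∀ m → ω ≤ m → m < ω + g → m * suc m * f m ≤ B) →
  ω * ∑ (interval ω g) f ≤ B
telescoping f B zero    ω h = subst (_≤ B) (sym (*-zeroʳ ω)) z≤n
telescoping f B (suc g) ω h = *-cancelˡ-≤ (suc ω) (begin
  suc ω * (ω * (f ω + S))              ≡⟨ solve 3 (λ w c s → (con 1 :+ w) :* (w :* (c :+ s))
                                                  := w :* (con 1 :+ w) :* c :+ w :* ((con 1 :+ w) :* s)) refl ω (f ω) S ⟩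
  ω * suc ω * f ω + ω * (suc ω * S)    ≤⟨ +-mono-≤ (h ω ≤-refl (m<m+n ω (s≤s z≤n))) (*-monoʳ-≤ ω rest) ⟩
  B + ω * B                            ∎)
  where
  open ≤-Reasoning
  S = ∑ (interval (suc ω) g) f
  rest : suc ω * S ≤ B
  rest = telescoping f B g (suc ω) (λ m ω<m m< → h m (<⇒≤ ω<m) (subst (m <_) (sym (+-suc ω g)) m<))

badSeqs : ℕ → ℕ → List (List Choice)
badSeqs ω M = concatMap (λ m → filter (λ cs → T? (badStepᵇ U₁ (pred m) cs)) (allSeqs M)) (interval ω (suc M ∸ ω))

bounded-interval : ∀ {ω m n} → ω ≤ m → m < ω + (n ∸ ω) → m < n
bounded-interval {ω} {m} {n} ω≤m m< with ω ≤? n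
... | yes ω≤n = subst (m <_) (m+[n∸m]≡n ω≤n) m<
... | no ω≰n  = ⊥-elim (<⇒≱ (subst (m <_) (trans (cong (ω +_) (m≤n⇒m∸n≡0 (<⇒≤ (≰⇒> ω≰n)))) (+-identityʳ ω)) m<) ω≤m)

switchIn⇒∈badSeqs : ∀ {ω M cs} → 2 ≤ ω → cs ∈ allSeqs M → SwitchIn ω M cs → cs ∈ badSeqs ω M
switchIn⇒∈badSeqs {ω} {M} {cs} ω≥2 cs∈ (m , ω≤m , m≤M , switch) =
  ∈-concatMap⁺ _ (lose (∈-interval⁺ (suc M ∸ ω) ω≤m (subst (m <_) (sym (m+[n∸m]≡n (≤-trans ω≤m (m≤n⇒m≤1+n m≤M)))) (s≤s m≤M)))
                       (∈-filter⁺ (λ cs → T? (badStepᵇ U₁ (pred m) cs)) cs∈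
                                  (subst T (sym (switch⇒badStep cs∈ (≤-trans ω≥2 ω≤m) m≤M switch)) tt)))

length-badSeqs : ∀ ω M → length (badSeqs ω M) ≡ ∑ (interval ω (suc M ∸ ω)) (λ m → #badStep 1 M U₁ (pred m))
length-badSeqs ω M = trans (sym (∑-length (badSeqs ω M))) (trans (∑-concatMap _ (interval ω (suc M ∸ ω)) _)
  (∑-cong (interval ω (suc M ∸ ω)) (λ m _ →
    trans (∑-length (filter _ (allSeqs M))) (length-filter-T (badStepᵇ U₁ (pred m)) (allSeqs M)))))

ω*length-badSeqs≤ : ∀ {ω} M → 2 ≤ ω → ω * length (badSeqs ω M) ≤ 18 * #seqs 1 M
ω*length-badSeqs≤ {ω} M ω≥2 = subst (λ L → ω * L ≤ 18 * #seqs 1 M) (sym (length-badSeqs ω M))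
  (telescoping (λ m → #badStep 1 M U₁ (pred m)) (18 * #seqs 1 M) (suc M ∸ ω) ω
    (λ m ω≤m m< → #badStep-bound M m (≤-trans ω≥2 ω≤m) (≤-pred (bounded-interval ω≤m m<))))

mainTheorem16 : (d : ℕ) → Σ ℕ λ N → (ω : ℕ) → N ≤ ω → (M : ℕ) →
                  ProbAtMostInv M d (SwitchIn ω M)
mainTheorem16 d = 18 * d + 2 , λ ω N≤ω M →
  badSeqs ω M , (λ cs cs∈ → switchIn⇒∈badSeqs (ω≥2 N≤ω) cs∈) , *-cancelˡ-≤ 18 (begin
    18 * (d * length (badSeqs ω M))   ≡⟨ sym (*-assoc 18 d _) ⟩
    18 * d * length (badSeqs ω M)     ≤⟨ *-monoˡ-≤ _ (≤-trans (m≤m+n (18 * d) 2) N≤ω) ⟩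
    ω * length (badSeqs ω M)          ≤⟨ ω*length-badSeqs≤ M (ω≥2 N≤ω) ⟩
    18 * length (allSeqs M)           ∎)
  where
  open ≤-Reasoning
  ω≥2 : ∀ {ω} → 18 * d + 2 ≤ ω → 2 ≤ ω
  ω≥2 = ≤-trans (m≤n+m 2 (18 * d))
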